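{- The set $\{\mathfrak{L}^*_{\alpha} : \alpha \vDash n\}$ is a basis of $\mathsf{QSym}_n$, and $\bigcup_{n \geq 0}\{ \mathfrak{L}^*_{\alpha} : \alpha \vDash n\}$ is a basis of $\mathsf{QSym}$.
   Context: $\mathsf{QSym}$ is the algebra of quasisymmetric functions over $\mathbb{Q}$, and $\mathsf{QSym}_n$ its degree-$n$ component, spanned by the monomial quasisymmetric functions $M_\beta=\sum_{i_1<\cdots<i_{\ell(\beta)}} x_{i_1}^{\beta_1}\cdots x_{i_{\ell(\beta)}}^{\beta_{\ell(\beta)}}$, $\beta\vDash n$. A composition $\alpha \vDash n$ is a tuple of positive integers summing to $n$; its diagram has left-justified rows, row $i$ (from the bottom) having $\alpha_i$ cells. A word is a necklace word if it is lexicographically weakly smallest among all its cyclic shifts. A lexical tableau of shape $\alpha$ is a filling of the diagram with positive integers such that the first column strictly increases from the bottom row upward and every row read left to right is a necklace word. For such $T$, $x^T=\prod_i x_i^{\#\{\text{entries equal to } i\}}$, and $\mathfrak{L}^*_\alpha=\sum_T x^T$ over all lexical tableaux $T$ of shape $\alpha$ (for $n=0$, $\mathfrak{L}^*_{()}=1$). -}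

module Defs where

open import Data.Nat using (ℕ; zero; suc; _+_; _<ᵇ_; _≡ᵇ_; _<_)
open import Data.Bool using (Bool; true; false; _∧_; _∨_; if_then_else_)
open import Data.List using (List; []; _∷_; _++_; length; take; drop; map; concatMap;
                             foldr; filter; upTo; applyUpTo)
open import Data.Nat.ListAction using (sum)
open import Data.Integer using (+_)
open import Data.Rational using (ℚ; _/_; 0ℚ) renaming (_+_ to _+ℚ_; _*_ to _*ℚ_)
open import Data.Product using (Σ; ∃; _×_)
open import Relation.Binary.PropositionalEquality using (_≡_)
open import Data.List.Membership.Propositional using (_∈_)

-- A monomial x₁^{a₁} x₂^{a₂} ⋯ x_m^{a_m} is represented by its exponent
-- list (a₁ ∷ … ∷ a_m ∷ []); variables beyond position m have exponent 0.
-- A formal power series is represented by its coefficient function.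
-- (Representations differing only by trailing zeros denote the same
-- monomial; all series considered below are quasisymmetric, which forces
-- their coefficient functions to respect this.)

Monomial : Set
Monomial = List ℕ

Series : Set
Series = Monomial → ℚ

toℚ : ℕ → ℚ
toℚ n = (+ n) / 1

degree : Monomial → ℕ
degree = sum

flatten : Monomial → List ℕ
flatten [] = []
flatten (zero ∷ a) = flatten a
flatten (suc b ∷ a) = suc b ∷ flatten a

-- f is quasisymmetric: the coefficient of x_{i₁}^{b₁}⋯x_{i_k}^{b_k}
-- (i₁ < ⋯ < i_k, all b_j > 0) equals that of x₁^{b₁}⋯x_k^{b_k}.
IsQuasisymmetric : Series → Set
IsQuasisymmetric f = ∀ (a : Monomial) → f a ≡ f (flatten a)

IsHomogeneous : ℕ → Series → Set
IsHomogeneous n f = ∀ (a : Monomial) → (degree a ≡ n → ⊥') → f a ≡ 0ℚ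
  where open import Data.Empty renaming (⊥ to ⊥')

InQSymₙ : ℕ → Series → Set
InQSymₙ n f = IsQuasisymmetric f × IsHomogeneous n f

InQSym : Series → Set
InQSym f = IsQuasisymmetric f × ∃ λ N → ∀ (a : Monomial) → N < degree a → f a ≡ 0ℚ

-- Compositions of n (lists of positive integers summing to n).
-- Every composition of n+1 is uniquely either 1 ∷ β or (b+1) ∷ r,
-- where β, resp. b ∷ r, is a composition of n.

compositions : ℕ → List (List ℕ)
compositions zero = [] ∷ []
compositions (suc n) = concatMap ext (compositions n)
  where
  ext : List ℕ → List (List ℕ)
  ext [] = (1 ∷ []) ∷ []
  ext (b ∷ r) = (1 ∷ b ∷ r) ∷ (suc b ∷ r) ∷ []

allB : {A : Set} → (A → Bool) → List A → Bool
allB p [] = true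
allB p (x ∷ xs) = p x ∧ allB p xs

lexLeq : List ℕ → List ℕ → Bool
lexLeq [] _ = true
lexLeq (x ∷ xs) [] = false
lexLeq (x ∷ xs) (y ∷ ys) = (x <ᵇ y) ∨ ((x ≡ᵇ y) ∧ lexLeq xs ys)

rotate : ℕ → List ℕ → List ℕ
rotate k w = drop k w ++ take k w

isNecklace : List ℕ → Bool
isNecklace w = allB (λ k → lexLeq w (rotate k w)) (upTo (length w))

strictlyIncreasing : List ℕ → Bool
strictlyIncreasing [] = true
strictlyIncreasing (x ∷ []) = true
strictlyIncreasing (x ∷ y ∷ r) = (x <ᵇ y) ∧ strictlyIncreasing (y ∷ r)

firstColumn : List (List ℕ) → List ℕ
firstColumn [] = []
firstColumn ([] ∷ rs) = firstColumn rs
firstColumn ((x ∷ _) ∷ rs) = x ∷ firstColumn rs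

-- A filling is a list of rows, bottom row first, each row read left to right.
isLexical : List (List ℕ) → Bool
isLexical T = strictlyIncreasing (firstColumn T) ∧ allB isNecklace T

words : ℕ → ℕ → List (List ℕ)
words m zero = [] ∷ []
words m (suc k) = concatMap (λ i → map (i ∷_) (words m k)) (applyUpTo suc m)

fillings : ℕ → List ℕ → List (List (List ℕ))
fillings m [] = [] ∷ []
fillings m (k ∷ α) = concatMap (λ w → map (w ∷_) (fillings m α)) (words m k)

count : ℕ → List ℕ → ℕ
count i [] = 0
count i (x ∷ xs) = (if i ≡ᵇ x then 1 else 0) + count i xs

entries : List (List ℕ) → List ℕ
entries = foldr _++_ []

content : ℕ → List (List ℕ) → List ℕ
content m T = map (λ i → count i (entries T)) (applyUpTo suc m)

eqList : List ℕ → List ℕ → Bool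
eqList [] [] = true
eqList (x ∷ xs) (y ∷ ys) = (x ≡ᵇ y) ∧ eqList xs ys
eqList _ _ = false

-- L*_α = Σ_T x^T over lexical tableaux T of shape α.  Its coefficient on
-- the monomial a = (a₁,…,a_m) is the number of lexical tableaux of shape α
-- whose entries lie in {1,…,m} with exactly a_i entries equal to i
-- (any tableau with an entry > m contributes to a different monomial).
lexicalCoeff : List ℕ → Monomial → ℕ
lexicalCoeff α a =
  length (filter (λ T → Data.Bool.T? (isLexical T ∧ eqList (content (length a) T) a))
                 (fillings (length a) α))
  where import Data.Bool

L* : List ℕ → Series
L* α a = toℚ (lexicalCoeff α a)

linComb : List (List ℕ) → (List ℕ → ℚ) → (List ℕ → Series) → Series
linComb S c f a = foldr (λ α acc → (c α *ℚ f α a) +ℚ acc) 0ℚ S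

compositionsUpTo : ℕ → List (List ℕ)
compositionsUpTo N = concatMap compositions (upTo (suc N))

zeroSeries : Series
zeroSeries _ = 0ℚ

IsBasisOfQSymₙ : ℕ → Set
IsBasisOfQSymₙ n =
  (∀ α → α ∈ compositions n → InQSymₙ n (L* α))
  × (∀ (c : List ℕ → ℚ) → (∀ a → linComb (compositions n) c L* a ≡ 0ℚ)
       → ∀ α → α ∈ compositions n → c α ≡ 0ℚ)
  × (∀ (f : Series) → InQSymₙ n f →
       Σ (List ℕ → ℚ) λ c → ∀ a → f a ≡ linComb (compositions n) c L* a)

IsBasisOfQSym : Set
IsBasisOfQSym =
  (∀ n α → α ∈ compositions n → InQSym (L* α))
  × (∀ (N : ℕ) (c : List ℕ → ℚ) → (∀ a → linComb (compositionsUpTo N) c L* a ≡ 0ℚ)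
       → ∀ α → α ∈ compositionsUpTo N → c α ≡ 0ℚ)
  × (∀ (f : Series) → InQSym f →
       Σ ℕ λ N → Σ (List ℕ → ℚ) λ c → ∀ a → f a ≡ linComb (compositionsUpTo N) c L* a)

-- Relabelling the entries along an order embedding preserves lexicality, so inserting a
-- zero exponent does not change this count: L*_α is quasisymmetric, and it is homogeneous
-- of degree |α|.  A necklace begins with its smallest letter and the first column
-- increases, so all 1s of a lexical tableau lie in its bottom row; peeling that row off
-- shows that the coefficient of M_β in L*_α vanishes unless β ≤ α lexicographically,
-- while the tableau whose i-th row is i^{α_i} makes the diagonal coefficients nonzero.
-- A family that is unitriangular for a total order on a finite index set is a basis
-- (Gaussian elimination from the top of the order), and QSym is the direct sum of the QSym_n.

module Submission where

open import Algebra.Bundles using (CommutativeMonoid)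
import Algebra.Properties.CommutativeSemigroup as CommutativeSemigroupProperties
open import Data.Bool using (Bool; true; false; _∧_; not; if_then_else_; T; T?)
open import Data.Bool.Properties using (∧-zeroʳ; ∧-assoc; T-≡)
open import Data.Empty using (⊥-elim)
import Data.Integer as ℤ
import Data.Integer.Properties as ℤ
open import Data.List using (List; []; _∷_; _++_; length; filter; filterᵇ; take; drop; map; concat; concatMap; foldr; replicate; upTo; applyUpTo)
import Data.List.Extrema as Extrema
open import Data.List.Membership.Propositional using (_∈_; find; lose)
open import Data.List.Membership.Propositional.Properties
  using (∈-concatMap⁺; ∈-concatMap⁻; ∈-map⁺; ∈-map⁻; ∈-applyUpTo⁻; ∈-filter⁺; ∈-filter⁻; ∈-upTo⁺; ∈-upTo⁻)
open import Data.List.Properties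
  using (map-++; map-∘; map-cong; map-applyUpTo; length-map; length-++; take-map; drop-map; ++-assoc; ++-identityʳ;
         concatMap-cong; ∷-injectiveˡ; ∷-injectiveʳ; length-replicate; ≡-dec; filter-++; filter-some; filter-reject; filter-notAll; filter-≐)
open import Data.List.Relation.Binary.Lex.Strict using (Lex-≤; base; halt; this; next)
import Data.List.Relation.Binary.Lex.Strict as Lex
open import Data.List.Relation.Binary.Pointwise using (Pointwise-≡⇒≡)
open import Data.List.Relation.Unary.All using (All; []; _∷_; tabulate)
import Data.List.Relation.Unary.All as All
open import Data.List.Relation.Unary.All.Properties using (concat⁺; replicate⁺)
open import Data.List.Relation.Unary.Any using (Any; here; there; any?)
open import Data.List.Relation.Unary.Unique.Propositional using (Unique; _∷_)
open import Data.List.Relation.Unary.Unique.Propositional.Properties using (upTo⁺)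
open import Data.Nat using (ℕ; zero; suc; _+_; _∸_; _<ᵇ_; _≡ᵇ_; _<_; _≤_; z≤n; s≤s; _≟_; _≤?_)
open import Data.Nat.Coprimality using (1-coprimeTo) renaming (sym to Coprime-sym)
open import Data.Nat.ListAction using (sum)
open import Data.Nat.Properties
  using (≡ᵇ⇒≡; ≡⇒≡ᵇ; <ᵇ⇒<; +-assoc; +-identityʳ; +-commutativeSemigroup; m≤m+n; m<n⇒n≢0; <⇒≤; ≤-reflexive; <-trans;
         <-≤-trans; ≤-<-trans; <-irrefl; <-isStrictTotalOrder; <⇒≢; m≤n⇒m≤1+n; m≤n⇒m<n∨m≡n; suc-injective;
         ≤-pred; n<1+n; ≤⇒≯; ≰⇒>)
open import Data.Product using (Σ; _×_; _,_; ∃; ∃₂; proj₁; proj₂)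
open import Data.Rational using (ℚ; 0ℚ; 1ℚ; mkℚ; _/_; 1/_; NonZero; ≢-nonZero)
  renaming (_+_ to _+ℚ_; _*_ to _*ℚ_; _-_ to _-ℚ_)
import Data.Rational.Properties as ℚ
open import Data.Rational.Solver using (module +-*-Solver)
open import Data.Sum using (_⊎_; inj₁; inj₂; [_,_]′)
open import Function using (_∘_; id)
open import Function.Bundles using (Equivalence)
open import Level using (0ℓ)
open import Relation.Binary.Bundles using (TotalOrder)
open import Relation.Binary.Core using (Rel)
open import Relation.Binary.Definitions using (DecidableEquality)
open import Relation.Binary.PropositionalEquality
open import Relation.Binary.Structures using (IsDecTotalOrder)
open import Relation.Nullary using (¬_; ¬?; yes; no; does; Dec)
open import Relation.Unary using (Pred; Decidable)

open import Defs

open CommutativeSemigroupProperties +-commutativeSemigroup using () renaming (interchange to +-interchange)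
open CommutativeSemigroupProperties (CommutativeMonoid.commutativeSemigroup ℚ.+-0-commutativeMonoid)
  using () renaming (interchange to +ℚ-interchange)
open +-*-Solver using (solve; _:+_; _:*_; _:-_; _:=_; con)

∧-trueˡ : ∀ {a b} → a ∧ b ≡ true → a ≡ true
∧-trueˡ {true} _ = refl

∧-trueʳ : ∀ {a b} → a ∧ b ≡ true → b ≡ true
∧-trueʳ {true} e = e

∧-true : ∀ {a b} → a ≡ true → b ≡ true → a ∧ b ≡ true
∧-true refl refl = refl

≡ᵇ-refl : ∀ n → (n ≡ᵇ n) ≡ true
≡ᵇ-refl zero = refl
≡ᵇ-refl (suc n) = ≡ᵇ-refl n

<ᵇ-irrefl : ∀ n → (n <ᵇ n) ≡ false
<ᵇ-irrefl zero = refl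
<ᵇ-irrefl (suc n) = <ᵇ-irrefl n

≡ᵇ-true⇒≡ : ∀ {m n} → (m ≡ᵇ n) ≡ true → m ≡ n
≡ᵇ-true⇒≡ {m} {n} e = ≡ᵇ⇒≡ m n (subst T (sym e) _)

<ᵇ-true⇒< : ∀ {m n} → (m <ᵇ n) ≡ true → m < n
<ᵇ-true⇒< {m} {n} e = <ᵇ⇒< m n (subst T (sym e) _)

allB-map : ∀ {A B : Set} (p : B → Bool) (f : A → B) xs → allB p (map f xs) ≡ allB (p ∘ f) xs
allB-map p f [] = refl
allB-map p f (x ∷ xs) = cong (p (f x) ∧_) (allB-map p f xs)

allB-cong : ∀ {A : Set} {p q : A → Bool} → (∀ x → p x ≡ q x) → ∀ xs → allB p xs ≡ allB q xs
allB-cong e [] = refl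
allB-cong e (x ∷ xs) = cong₂ _∧_ (e x) (allB-cong e xs)

allB-++ : ∀ {A : Set} (p : A → Bool) xs ys → allB p (xs ++ ys) ≡ allB p xs ∧ allB p ys
allB-++ p [] ys = refl
allB-++ p (x ∷ xs) ys = trans (cong (p x ∧_) (allB-++ p xs ys)) (sym (∧-assoc (p x) _ _))

allB-allB : ∀ {A : Set} (p : A → Bool) xss → allB (allB p) xss ≡ allB p (concat xss)
allB-allB p [] = refl
allB-allB p (xs ∷ xss) = trans (cong (allB p xs ∧_) (allB-allB p xss)) (sym (allB-++ p xs _))

allB-∈ : ∀ {A : Set} (p : A → Bool) {x l} → allB p l ≡ true → x ∈ l → p x ≡ true
allB-∈ p {l = y ∷ l} all (here refl) = ∧-trueˡ all
allB-∈ p {l = y ∷ l} all (there x∈) = allB-∈ p (∧-trueʳ {p y} all) x∈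

allB-true : ∀ {A : Set} (p : A → Bool) → (∀ x → p x ≡ true) → ∀ l → allB p l ≡ true
allB-true p p-true [] = refl
allB-true p p-true (x ∷ l) rewrite p-true x = allB-true p p-true l

filter-⊆ : ∀ {A : Set} {P Q : Pred A 0ℓ} (P? : Decidable P) (Q? : Decidable Q) → (∀ {x} → P x → Q x) →
  ∀ xs → filter P? (filter Q? xs) ≡ filter P? xs
filter-⊆ P? Q? P⇒Q [] = refl
filter-⊆ P? Q? P⇒Q (x ∷ xs) with Q? x
... | no ¬Qx = trans (filter-⊆ P? Q? P⇒Q xs) (sym (filter-reject P? (¬Qx ∘ P⇒Q)))
... | yes _ with does (P? x)
...   | true = cong (x ∷_) (filter-⊆ P? Q? P⇒Q xs)
...   | false = filter-⊆ P? Q? P⇒Q xs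

length-filter-⊂ : ∀ {A : Set} {P Q : Pred A 0ℓ} (P? : Decidable P) (Q? : Decidable Q) → (∀ {x} → P x → Q x) →
  ∀ {x xs} → x ∈ xs → Q x → ¬ P x → length (filter P? xs) < length (filter Q? xs)
length-filter-⊂ P? Q? P⇒Q {xs = xs} x∈ Qx ¬Px =
  subst (_< length (filter Q? xs)) (cong length (filter-⊆ P? Q? P⇒Q xs))
        (filter-notAll P? (filter Q? xs) (lose (∈-filter⁺ Q? x∈ Qx) ¬Px))

filterᵇ-filterᵇ : ∀ {A : Set} (p q : A → Bool) → (∀ x → p x ≡ true → q x ≡ true) → ∀ xs →
  filterᵇ p (filterᵇ q xs) ≡ filterᵇ p xs
filterᵇ-filterᵇ p q p⇒q = filter-⊆ (T? ∘ p) (T? ∘ q) (λ {x} → Equivalence.from T-≡ ∘ p⇒q x ∘ Equivalence.to T-≡)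

filterᵇ-map : ∀ {A B : Set} (p : B → Bool) (f : A → B) xs → filterᵇ p (map f xs) ≡ map f (filterᵇ (p ∘ f) xs)
filterᵇ-map p f [] = refl
filterᵇ-map p f (x ∷ xs) with p (f x)
... | true = cong (f x ∷_) (filterᵇ-map p f xs)
... | false = filterᵇ-map p f xs

filterᵇ-cong : ∀ {A : Set} {p q : A → Bool} → (∀ x → p x ≡ q x) → ∀ xs → filterᵇ p xs ≡ filterᵇ q xs
filterᵇ-cong {p = p} {q} p≗q = filter-≐ (T? ∘ p) (T? ∘ q) ((λ {x} → subst T (p≗q x)) , (λ {x} → subst T (sym (p≗q x))))

insertAt : {A : Set} → ℕ → A → List A → List A
insertAt zero x l = x ∷ l
insertAt (suc j) x [] = x ∷ []
insertAt (suc j) x (y ∷ l) = y ∷ insertAt j x l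

map-insertAt : ∀ {A B : Set} (f : A → B) j x l → map f (insertAt j x l) ≡ insertAt j (f x) (map f l)
map-insertAt f zero x l = refl
map-insertAt f (suc j) x [] = refl
map-insertAt f (suc j) x (y ∷ l) = cong (f y ∷_) (map-insertAt f j x l)

length-insertAt : ∀ {A : Set} j (x : A) l → length (insertAt j x l) ≡ suc (length l)
length-insertAt zero x l = refl
length-insertAt (suc j) x [] = refl
length-insertAt (suc j) x (y ∷ l) = cong suc (length-insertAt j x l)

++-∷-insertAt : ∀ {A : Set} (p : List A) x q → p ++ x ∷ q ≡ insertAt (length p) x (p ++ q)
++-∷-insertAt [] x q = refl
++-∷-insertAt (y ∷ p) x q = cong (y ∷_) (++-∷-insertAt p x q)

filterᵇ-insertAt : ∀ {A : Set} (p : A → Bool) j x l → p x ≡ false → filterᵇ p (insertAt j x l) ≡ filterᵇ p l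
filterᵇ-insertAt p zero x l px rewrite px = refl
filterᵇ-insertAt p (suc j) x [] px rewrite px = refl
filterᵇ-insertAt p (suc j) x (y ∷ l) px with p y
... | true = cong (y ∷_) (filterᵇ-insertAt p j x l px)
... | false = filterᵇ-insertAt p j x l px

drop-∈ : ∀ {A : Set} {y : A} w → y ∈ w → ∃₂ λ k rest → k < length w × drop k w ≡ y ∷ rest
drop-∈ (x ∷ w) (here refl) = 0 , w , s≤s z≤n , refl
drop-∈ (x ∷ w) (there y∈) with drop-∈ w y∈
... | k , rest , k<len , eq = suc k , rest , s≤s k<len , eq

drop-replicate : ∀ {A : Set} j n (x : A) → drop j (replicate n x) ≡ replicate (n ∸ j) x
drop-replicate zero n x = refl
drop-replicate (suc j) zero x = refl
drop-replicate (suc j) (suc n) x = drop-replicate j n x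

replicate-++-∷ : ∀ {A : Set} n (x : A) l → replicate n x ++ x ∷ l ≡ x ∷ replicate n x ++ l
replicate-++-∷ zero x l = refl
replicate-++-∷ (suc n) x l = cong (x ∷_) (replicate-++-∷ n x l)

conses : {A : Set} → List A → List (List A) → List (List A)
conses xs ys = concatMap (λ x → map (x ∷_) ys) xs

∈-conses⁻ : ∀ {A : Set} (xs : List A) ys {t} → t ∈ conses xs ys →
  ∃₂ λ x y → t ≡ x ∷ y × x ∈ xs × y ∈ ys
∈-conses⁻ xs ys t∈ with find (∈-concatMap⁻ _ {xs = xs} t∈)
... | x , x∈ , t∈x∷ys with ∈-map⁻ (x ∷_) t∈x∷ys
... | y , y∈ , refl = x , y , refl , x∈ , y∈

∈-conses⁺ : ∀ {A : Set} (xs : List A) ys {x y} → x ∈ xs → y ∈ ys → (x ∷ y) ∈ conses xs ys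
∈-conses⁺ xs ys x∈ y∈ = ∈-concatMap⁺ _ {xs = xs} (lose x∈ (∈-map⁺ _ y∈))

filterᵇ-allB-map-∷-accept : ∀ {A : Set} (q : A → Bool) {x} ys → q x ≡ true →
  filterᵇ (allB q) (map (x ∷_) ys) ≡ map (x ∷_) (filterᵇ (allB q) ys)
filterᵇ-allB-map-∷-accept q [] qx = refl
filterᵇ-allB-map-∷-accept q {x} (y ∷ ys) qx rewrite qx with allB q y
... | true = cong ((x ∷ y) ∷_) (filterᵇ-allB-map-∷-accept q ys qx)
... | false = filterᵇ-allB-map-∷-accept q ys qx

filterᵇ-allB-map-∷-reject : ∀ {A : Set} (q : A → Bool) {x} ys → q x ≡ false →
  filterᵇ (allB q) (map (x ∷_) ys) ≡ []
filterᵇ-allB-map-∷-reject q [] qx = refl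
filterᵇ-allB-map-∷-reject q (y ∷ ys) qx rewrite qx = filterᵇ-allB-map-∷-reject q ys qx

filterᵇ-allB-conses : ∀ {A : Set} (q : A → Bool) xs ys →
  filterᵇ (allB q) (conses xs ys) ≡ conses (filterᵇ q xs) (filterᵇ (allB q) ys)
filterᵇ-allB-conses q [] ys = refl
filterᵇ-allB-conses q (x ∷ xs) ys rewrite filter-++ (T? ∘ allB q) (map (x ∷_) ys) (conses xs ys) with q x in qx
... | true = cong₂ _++_ (filterᵇ-allB-map-∷-accept q ys qx) (filterᵇ-allB-conses q xs ys)
... | false = cong₂ _++_ (filterᵇ-allB-map-∷-reject q ys qx) (filterᵇ-allB-conses q xs ys)

conses-map : ∀ {A B : Set} (g : A → B) xs ys → conses (map g xs) (map (map g) ys) ≡ map (map g) (conses xs ys)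
conses-map g [] ys = refl
conses-map g (x ∷ xs) ys =
  trans (cong₂ _++_ (trans (sym (map-∘ ys)) (map-∘ ys)) (conses-map g xs ys))
        (sym (map-++ (map g) (map (x ∷_) ys) (conses xs ys)))

sum-map-zero : ∀ {A : Set} (f : A → ℕ) → (∀ x → f x ≡ 0) → ∀ l → sum (map f l) ≡ 0
sum-map-zero f f≡0 [] = refl
sum-map-zero f f≡0 (x ∷ l) rewrite f≡0 x = sum-map-zero f f≡0 l

sum-map-+ : ∀ {A : Set} (f g : A → ℕ) l → sum (map (λ x → f x + g x) l) ≡ sum (map f l) + sum (map g l)
sum-map-+ f g [] = refl
sum-map-+ f g (x ∷ l) = trans (cong (f x + g x +_) (sum-map-+ f g l)) (+-interchange (f x) (g x) _ _)

count-++ : ∀ i xs ys → count i (xs ++ ys) ≡ count i xs + count i ys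
count-++ i [] ys = refl
count-++ i (x ∷ xs) ys = trans (cong (_ +_) (count-++ i xs ys)) (sym (+-assoc (if i ≡ᵇ x then 1 else 0) _ _))

count-≤-length : ∀ i l → count i l ≤ length l
count-≤-length i [] = z≤n
count-≤-length i (x ∷ l) with i ≡ᵇ x
... | true = s≤s (count-≤-length i l)
... | false = m≤n⇒m≤1+n (count-≤-length i l)

count≡length⇒All≡ : ∀ i l → count i l ≡ length l → All (_≡ i) l
count≡length⇒All≡ i [] _ = []
count≡length⇒All≡ i (x ∷ l) c≡len with i ≡ᵇ x in i≡x
... | true = sym (≡ᵇ-true⇒≡ i≡x) ∷ count≡length⇒All≡ i l (suc-injective c≡len)
... | false = ⊥-elim (<-irrefl c≡len (s≤s (count-≤-length i l)))

count-All≢ : ∀ i l → All (i ≢_) l → count i l ≡ 0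
count-All≢ i [] [] = refl
count-All≢ i (x ∷ l) (i≢x ∷ i≢l) with i ≡ᵇ x in i≡x
... | true = ⊥-elim (i≢x (≡ᵇ-true⇒≡ i≡x))
... | false = count-All≢ i l i≢l

count-All≡ : ∀ i l → All (_≡ i) l → count i l ≡ length l
count-All≡ i [] [] = refl
count-All≡ i (x ∷ l) (refl ∷ l≡i) rewrite ≡ᵇ-refl i = cong suc (count-All≡ i l l≡i)

relabel : (ℕ → ℕ) → List (List ℕ) → List (List ℕ)
relabel g = map (map g)

module OrderEmbedding (g : ℕ → ℕ)
  (g-<ᵇ : ∀ x y → (g x <ᵇ g y) ≡ (x <ᵇ y)) (g-≡ᵇ : ∀ x y → (g x ≡ᵇ g y) ≡ (x ≡ᵇ y)) where

  lexLeq-map : ∀ u v → lexLeq (map g u) (map g v) ≡ lexLeq u v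
  lexLeq-map [] v = refl
  lexLeq-map (x ∷ u) [] = refl
  lexLeq-map (x ∷ u) (y ∷ v) rewrite g-<ᵇ x y | g-≡ᵇ x y | lexLeq-map u v = refl

  rotate-map : ∀ k w → rotate k (map g w) ≡ map g (rotate k w)
  rotate-map k w rewrite drop-map {f = g} k w | take-map {f = g} k w = sym (map-++ g (drop k w) (take k w))

  isNecklace-map : ∀ w → isNecklace (map g w) ≡ isNecklace w
  isNecklace-map w rewrite length-map g w =
    allB-cong (λ k → trans (cong (lexLeq (map g w)) (rotate-map k w)) (lexLeq-map w (rotate k w))) (upTo (length w))

  strictlyIncreasing-map : ∀ l → strictlyIncreasing (map g l) ≡ strictlyIncreasing l
  strictlyIncreasing-map [] = refl
  strictlyIncreasing-map (x ∷ []) = refl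
  strictlyIncreasing-map (x ∷ y ∷ l) = cong₂ _∧_ (g-<ᵇ x y) (strictlyIncreasing-map (y ∷ l))

  firstColumn-map : ∀ T → firstColumn (relabel g T) ≡ map g (firstColumn T)
  firstColumn-map [] = refl
  firstColumn-map ([] ∷ T) = firstColumn-map T
  firstColumn-map ((x ∷ r) ∷ T) = cong (g x ∷_) (firstColumn-map T)

  allB-isNecklace-map : ∀ T → allB isNecklace (relabel g T) ≡ allB isNecklace T
  allB-isNecklace-map T = trans (allB-map isNecklace (map g) T) (allB-cong isNecklace-map T)

  isLexical-map : ∀ T → isLexical (relabel g T) ≡ isLexical T
  isLexical-map T rewrite firstColumn-map T | strictlyIncreasing-map (firstColumn T) =
    cong (strictlyIncreasing (firstColumn T) ∧_) (allB-isNecklace-map T)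

-- punchIn j is the increasing bijection from ℕ onto ℕ ∖ {suc j}.
punchIn : ℕ → ℕ → ℕ
punchIn j zero = zero
punchIn zero (suc x) = suc (suc x)
punchIn (suc j) (suc x) = suc (punchIn j x)

punchIn-<ᵇ : ∀ j x y → (punchIn j x <ᵇ punchIn j y) ≡ (x <ᵇ y)
punchIn-<ᵇ j zero zero = refl
punchIn-<ᵇ zero zero (suc y) = refl
punchIn-<ᵇ (suc j) zero (suc y) = refl
punchIn-<ᵇ zero (suc x) zero = refl
punchIn-<ᵇ (suc j) (suc x) zero = refl
punchIn-<ᵇ zero (suc x) (suc y) = refl
punchIn-<ᵇ (suc j) (suc x) (suc y) = punchIn-<ᵇ j x y

punchIn-≡ᵇ : ∀ j x y → (punchIn j x ≡ᵇ punchIn j y) ≡ (x ≡ᵇ y)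
punchIn-≡ᵇ j zero zero = refl
punchIn-≡ᵇ zero zero (suc y) = refl
punchIn-≡ᵇ (suc j) zero (suc y) = refl
punchIn-≡ᵇ zero (suc x) zero = refl
punchIn-≡ᵇ (suc j) (suc x) zero = refl
punchIn-≡ᵇ zero (suc x) (suc y) = refl
punchIn-≡ᵇ (suc j) (suc x) (suc y) = punchIn-≡ᵇ j x y

punchIn-≢ : ∀ j x → (suc j ≡ᵇ punchIn j x) ≡ false
punchIn-≢ zero zero = refl
punchIn-≢ zero (suc x) = refl
punchIn-≢ (suc j) zero = refl
punchIn-≢ (suc j) (suc x) = punchIn-≢ j x

module PunchIn (j : ℕ) = OrderEmbedding (punchIn j) (punchIn-<ᵇ j) (punchIn-≡ᵇ j)

entries-relabel : ∀ g T → entries (relabel g T) ≡ map g (entries T)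
entries-relabel g [] = refl
entries-relabel g (r ∷ T) = trans (cong (map g r ++_) (entries-relabel g T)) (sym (map-++ g r (entries T)))

count-punchIn : ∀ j y xs → count (punchIn j y) (map (punchIn j) xs) ≡ count y xs
count-punchIn j y [] = refl
count-punchIn j y (x ∷ xs) rewrite punchIn-≡ᵇ j y x = cong (_ +_) (count-punchIn j y xs)

count-punchIn-gap : ∀ j xs → count (suc j) (map (punchIn j) xs) ≡ 0
count-punchIn-gap j [] = refl
count-punchIn-gap j (x ∷ xs) rewrite punchIn-≢ j x = count-punchIn-gap j xs

letters : ℕ → List ℕ
letters m = applyUpTo suc m

letters-suc : ∀ m → letters (suc m) ≡ 1 ∷ map suc (letters m)
letters-suc m = cong (1 ∷_) (sym (map-applyUpTo suc suc m))

letters-punchIn : ∀ j m → j ≤ m → letters (suc m) ≡ insertAt j (suc j) (map (punchIn j) (letters m))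
letters-punchIn zero m _ = cong (1 ∷_) (sym (map-applyUpTo suc (punchIn zero) m))
letters-punchIn (suc j) (suc m) (s≤s j≤m) = cong (1 ∷_) (begin
    applyUpTo (suc ∘ suc) (suc m)
  ≡⟨ sym (map-applyUpTo suc suc (suc m)) ⟩
    map suc (letters (suc m))
  ≡⟨ cong (map suc) (letters-punchIn j m j≤m) ⟩
    map suc (insertAt j (suc j) (map (punchIn j) (letters m)))
  ≡⟨ map-insertAt suc j (suc j) _ ⟩
    insertAt j (suc (suc j)) (map suc (map (punchIn j) (letters m)))
  ≡⟨ cong (insertAt j (suc (suc j))) (trans (sym (map-∘ (letters m))) (map-applyUpTo suc (suc ∘ punchIn j) m)) ⟩
    insertAt j (suc (suc j)) (applyUpTo (suc ∘ punchIn j ∘ suc) m)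
  ≡⟨ cong (insertAt j (suc (suc j))) (sym (map-applyUpTo (suc ∘ suc) (punchIn (suc j)) m)) ⟩
    insertAt j (suc (suc j)) (map (punchIn (suc j)) (applyUpTo (suc ∘ suc) m))
  ∎)
  where open ≡-Reasoning

avoids : ℕ → ℕ → Bool
avoids i x = not (i ≡ᵇ x)

count≡0⇒allB-avoids : ∀ i xs → count i xs ≡ 0 → allB (avoids i) xs ≡ true
count≡0⇒allB-avoids i [] _ = refl
count≡0⇒allB-avoids i (x ∷ xs) c≡0 with i ≡ᵇ x
... | false = count≡0⇒allB-avoids i xs c≡0

filterᵇ-avoids-punchIn : ∀ j l → filterᵇ (avoids (suc j)) (map (punchIn j) l) ≡ map (punchIn j) l
filterᵇ-avoids-punchIn j [] = refl
filterᵇ-avoids-punchIn j (x ∷ l) rewrite punchIn-≢ j x = cong (punchIn j x ∷_) (filterᵇ-avoids-punchIn j l)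

filterᵇ-avoids-letters : ∀ j m → j ≤ m → filterᵇ (avoids (suc j)) (letters (suc m)) ≡ map (punchIn j) (letters m)
filterᵇ-avoids-letters j m j≤m = begin
    filterᵇ (avoids (suc j)) (letters (suc m))
  ≡⟨ cong (filterᵇ (avoids (suc j))) (letters-punchIn j m j≤m) ⟩
    filterᵇ (avoids (suc j)) (insertAt j (suc j) (map (punchIn j) (letters m)))
  ≡⟨ filterᵇ-insertAt (avoids (suc j)) j (suc j) _ (cong not (≡ᵇ-refl j)) ⟩
    filterᵇ (avoids (suc j)) (map (punchIn j) (letters m))
  ≡⟨ filterᵇ-avoids-punchIn j (letters m) ⟩
    map (punchIn j) (letters m)
  ∎
  where open ≡-Reasoning

filterᵇ-avoids-words : ∀ j m → j ≤ m → ∀ k →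
  filterᵇ (allB (avoids (suc j))) (words (suc m) k) ≡ map (map (punchIn j)) (words m k)
filterᵇ-avoids-words j m j≤m zero = refl
filterᵇ-avoids-words j m j≤m (suc k) = begin
    filterᵇ (allB (avoids (suc j))) (conses (letters (suc m)) (words (suc m) k))
  ≡⟨ filterᵇ-allB-conses (avoids (suc j)) (letters (suc m)) (words (suc m) k) ⟩
    conses (filterᵇ (avoids (suc j)) (letters (suc m))) (filterᵇ (allB (avoids (suc j))) (words (suc m) k))
  ≡⟨ cong₂ conses (filterᵇ-avoids-letters j m j≤m) (filterᵇ-avoids-words j m j≤m k) ⟩
    conses (map (punchIn j) (letters m)) (map (map (punchIn j)) (words m k))
  ≡⟨ conses-map (punchIn j) (letters m) (words m k) ⟩
    map (map (punchIn j)) (words m (suc k))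
  ∎
  where open ≡-Reasoning

filterᵇ-avoids-fillings : ∀ j m → j ≤ m → ∀ α →
  filterᵇ (allB (allB (avoids (suc j)))) (fillings (suc m) α) ≡ map (relabel (punchIn j)) (fillings m α)
filterᵇ-avoids-fillings j m j≤m [] = refl
filterᵇ-avoids-fillings j m j≤m (k ∷ α) = begin
    filterᵇ (allB (allB (avoids (suc j)))) (conses (words (suc m) k) (fillings (suc m) α))
  ≡⟨ filterᵇ-allB-conses (allB (avoids (suc j))) (words (suc m) k) (fillings (suc m) α) ⟩
    conses (filterᵇ (allB (avoids (suc j))) (words (suc m) k)) (filterᵇ (allB (allB (avoids (suc j)))) (fillings (suc m) α))
  ≡⟨ cong₂ conses (filterᵇ-avoids-words j m j≤m k) (filterᵇ-avoids-fillings j m j≤m α) ⟩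
    conses (map (map (punchIn j)) (words m k)) (map (relabel (punchIn j)) (fillings m α))
  ≡⟨ conses-map (map (punchIn j)) (words m k) (fillings m α) ⟩
    map (relabel (punchIn j)) (fillings m (k ∷ α))
  ∎
  where open ≡-Reasoning

IsLetter : ℕ → ℕ → Set
IsLetter m x = 1 ≤ x × x ≤ m

∈-letters⁻ : ∀ {m x} → x ∈ letters m → IsLetter m x
∈-letters⁻ x∈ with ∈-applyUpTo⁻ suc x∈
... | i , i<m , refl = s≤s z≤n , i<m

∈-words⁻ : ∀ {m k w} → w ∈ words m k → length w ≡ k × All (IsLetter m) w
∈-words⁻ {k = zero} (here refl) = refl , []
∈-words⁻ {m} {suc k} w∈ with ∈-conses⁻ (letters m) (words m k) w∈
... | i , w′ , refl , i∈ , w′∈ with ∈-words⁻ {m} {k} w′∈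
... | refl , w′-letters = refl , ∈-letters⁻ i∈ ∷ w′-letters

∈-fillings⁻ : ∀ {m α T} → T ∈ fillings m α → map length T ≡ α × All (All (IsLetter m)) T
∈-fillings⁻ {α = []} (here refl) = refl , []
∈-fillings⁻ {m} {k ∷ α} T∈ with ∈-conses⁻ (words m k) (fillings m α) T∈
... | r , T′ , refl , r∈ , T′∈ with ∈-words⁻ {m} {k} r∈ | ∈-fillings⁻ {m} {α} T′∈
... | refl , r-letters | refl , T′-letters = refl , r-letters ∷ T′-letters

occurrences : List (List ℕ) → ℕ → ℕ
occurrences T i = count i (entries T)

occurrences-∷ : ∀ i r T → occurrences (r ∷ T) i ≡ count i r + occurrences T i
occurrences-∷ i r T = count-++ i r (entries T)

occurrences-relabel-punchIn : ∀ j y T → occurrences (relabel (punchIn j) T) (punchIn j y) ≡ occurrences T y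
occurrences-relabel-punchIn j y T = trans (cong (count (punchIn j y)) (entries-relabel (punchIn j) T)) (count-punchIn j y (entries T))

occurrences-relabel-punchIn-gap : ∀ j T → occurrences (relabel (punchIn j) T) (suc j) ≡ 0
occurrences-relabel-punchIn-gap j T = trans (cong (count (suc j)) (entries-relabel (punchIn j) T)) (count-punchIn-gap j (entries T))

content-upTo : ∀ m T → content m T ≡ map (occurrences T ∘ suc) (upTo m)
content-upTo m T = trans (map-applyUpTo suc (occurrences T) m) (sym (map-applyUpTo id (occurrences T ∘ suc) m))

content-suc : ∀ m T → content (suc m) T ≡ occurrences T 1 ∷ map (occurrences T ∘ suc ∘ suc) (upTo m)
content-suc m T = cong (occurrences T 1 ∷_) (trans (map-applyUpTo (suc ∘ suc) (occurrences T) m)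
                                                   (sym (map-applyUpTo id (occurrences T ∘ suc ∘ suc) m)))

content-insertAt : ∀ j m → j ≤ m → ∀ T →
  content (suc m) T ≡ insertAt j (occurrences T (suc j)) (map (occurrences T ∘ punchIn j) (letters m))
content-insertAt j m j≤m T = begin
    map (occurrences T) (letters (suc m))
  ≡⟨ cong (map (occurrences T)) (letters-punchIn j m j≤m) ⟩
    map (occurrences T) (insertAt j (suc j) (map (punchIn j) (letters m)))
  ≡⟨ map-insertAt (occurrences T) j (suc j) _ ⟩
    insertAt j (occurrences T (suc j)) (map (occurrences T) (map (punchIn j) (letters m)))
  ≡⟨ cong (insertAt j _) (sym (map-∘ (letters m))) ⟩
    insertAt j (occurrences T (suc j)) (map (occurrences T ∘ punchIn j) (letters m))
  ∎
  where open ≡-Reasoning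

content-relabel-punchIn : ∀ j m → j ≤ m → ∀ T → content (suc m) (relabel (punchIn j) T) ≡ insertAt j 0 (content m T)
content-relabel-punchIn j m j≤m T = trans (content-insertAt j m j≤m (relabel (punchIn j) T))
  (cong₂ (insertAt j) (occurrences-relabel-punchIn-gap j T) (map-cong (λ y → occurrences-relabel-punchIn j y T) (letters m)))

content-ones-∷ : ∀ m r T → All (_≡ 1) r →
  content (suc m) (r ∷ T) ≡ (length r + occurrences T 1) ∷ map (occurrences T ∘ suc ∘ suc) (upTo m)
content-ones-∷ m r T ones = trans (content-suc m (r ∷ T)) (cong₂ _∷_
  (trans (occurrences-∷ 1 r T) (cong (_+ occurrences T 1) (count-All≡ 1 r ones)))
  (map-cong (λ i → trans (occurrences-∷ (suc (suc i)) r T)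
                         (cong (_+ occurrences T (suc (suc i))) (count-All≢ (suc (suc i)) r (All.map (λ { refl () }) ones))))
            (upTo m)))

eqList-sound : ∀ {l l′} → eqList l l′ ≡ true → l ≡ l′
eqList-sound {[]} {[]} _ = refl
eqList-sound {x ∷ l} {y ∷ l′} e = cong₂ _∷_ (≡ᵇ-true⇒≡ (∧-trueˡ e)) (eqList-sound (∧-trueʳ {x ≡ᵇ y} e))

eqList-refl : ∀ l → eqList l l ≡ true
eqList-refl [] = refl
eqList-refl (x ∷ l) rewrite ≡ᵇ-refl x = eqList-refl l

eqList-[]-insertAt : ∀ j y l → eqList [] (insertAt j y l) ≡ false
eqList-[]-insertAt zero y l = refl
eqList-[]-insertAt (suc j) y [] = refl
eqList-[]-insertAt (suc j) y (z ∷ l) = refl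

eqList-insertAt-[] : ∀ j x l → eqList (insertAt j x l) [] ≡ false
eqList-insertAt-[] zero x l = refl
eqList-insertAt-[] (suc j) x [] = refl
eqList-insertAt-[] (suc j) x (z ∷ l) = refl

eqList-insertAt : ∀ j x y l l′ → eqList (insertAt j x l) (insertAt j y l′) ≡ (x ≡ᵇ y) ∧ eqList l l′
eqList-insertAt zero x y l l′ = refl
eqList-insertAt (suc j) x y [] [] = refl
eqList-insertAt (suc j) x y [] (z ∷ l′) rewrite eqList-[]-insertAt j y l′ = trans (∧-zeroʳ _) (sym (∧-zeroʳ _))
eqList-insertAt (suc j) x y (z ∷ l) [] rewrite eqList-insertAt-[] j x l = trans (∧-zeroʳ _) (sym (∧-zeroʳ _))
eqList-insertAt (suc j) x y (z ∷ l) (w ∷ l′) with z ≡ᵇ w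
... | true = eqList-insertAt j x y l l′
... | false = sym (∧-zeroʳ _)

lexicalWithContent : ℕ → Monomial → List (List ℕ) → Bool
lexicalWithContent m a T = isLexical T ∧ eqList (content m T) a

-- lexicalCoeff α a is tableauCount (length a) a α by definition.
tableauCount : ℕ → Monomial → List ℕ → ℕ
tableauCount m a α = length (filterᵇ (lexicalWithContent m a) (fillings m α))

IsLexicalTableau : ℕ → List ℕ → Monomial → List (List ℕ) → Set
IsLexicalTableau m α a T = T ∈ fillings m α × isLexical T ≡ true × content m T ≡ a

lexicalCoeff≢0⇒∃tableau : ∀ α a → lexicalCoeff α a ≢ 0 → ∃ (IsLexicalTableau (length a) α a)
lexicalCoeff≢0⇒∃tableau α a coeff≢0 with filterᵇ (lexicalWithContent (length a) a) (fillings (length a) α) in tableaux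
... | [] = ⊥-elim (coeff≢0 refl)
... | T ∷ _ with ∈-filter⁻ (T? ∘ lexicalWithContent (length a) a) (subst (T ∈_) (sym tableaux) (here refl))
... | T∈ , lex = T , T∈ , ∧-trueˡ lex′ , eqList-sound (∧-trueʳ {isLexical T} lex′)
  where lex′ = Equivalence.to T-≡ lex

tableau⇒lexicalCoeff≢0 : ∀ α a T → IsLexicalTableau (length a) α a T → lexicalCoeff α a ≢ 0
tableau⇒lexicalCoeff≢0 α a T (T∈ , lex , content≡a) =
  m<n⇒n≢0 (filter-some (T? ∘ lexicalWithContent (length a) a)
            (lose T∈ (Equivalence.from T-≡ (∧-true lex (subst (λ c → eqList (content (length a) T) c ≡ true) content≡a
                                                            (eqList-refl (content (length a) T)))))))

lexicalWithContent-relabel : ∀ j m → j ≤ m → ∀ a T →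
  lexicalWithContent (suc m) (insertAt j 0 a) (relabel (punchIn j) T) ≡ lexicalWithContent m a T
lexicalWithContent-relabel j m j≤m a T
  rewrite content-relabel-punchIn j m j≤m T | eqList-insertAt j 0 0 (content m T) a =
  cong (_∧ eqList (content m T) a) (PunchIn.isLexical-map j T)

lexicalWithContent-avoids : ∀ j m → j ≤ m → ∀ a T →
  lexicalWithContent (suc m) (insertAt j 0 a) T ≡ true → allB (allB (avoids (suc j))) T ≡ true
lexicalWithContent-avoids j m j≤m a T lex
  rewrite content-insertAt j m j≤m T | eqList-insertAt j (occurrences T (suc j)) 0 (map (occurrences T ∘ punchIn j) (letters m)) a =
  trans (allB-allB (avoids (suc j)) T)
        (count≡0⇒allB-avoids (suc j) (entries T) (≡ᵇ-true⇒≡ (∧-trueˡ (∧-trueʳ {isLexical T} lex))))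

-- The tableaux counted on the left have no entry j + 1, so they are exactly the punchIn j-relabellings
-- of the tableaux counted on the right.
tableauCount-insertAt-0 : ∀ j m → j ≤ m → ∀ a α → tableauCount (suc m) (insertAt j 0 a) α ≡ tableauCount m a α
tableauCount-insertAt-0 j m j≤m a α = trans (cong length (begin
    filterᵇ lex₀ (fillings (suc m) α)
  ≡⟨ sym (filterᵇ-filterᵇ lex₀ (allB (allB (avoids (suc j)))) (lexicalWithContent-avoids j m j≤m a) (fillings (suc m) α)) ⟩
    filterᵇ lex₀ (filterᵇ (allB (allB (avoids (suc j)))) (fillings (suc m) α))
  ≡⟨ cong (filterᵇ lex₀) (filterᵇ-avoids-fillings j m j≤m α) ⟩
    filterᵇ lex₀ (map (relabel (punchIn j)) (fillings m α))
  ≡⟨ filterᵇ-map lex₀ (relabel (punchIn j)) (fillings m α) ⟩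
    map (relabel (punchIn j)) (filterᵇ (lex₀ ∘ relabel (punchIn j)) (fillings m α))
  ≡⟨ cong (map (relabel (punchIn j))) (filterᵇ-cong (lexicalWithContent-relabel j m j≤m a) (fillings m α)) ⟩
    map (relabel (punchIn j)) (filterᵇ (lexicalWithContent m a) (fillings m α))
  ∎)) (length-map (relabel (punchIn j)) (filterᵇ (lexicalWithContent m a) (fillings m α)))
  where
  open ≡-Reasoning
  lex₀ = lexicalWithContent (suc m) (insertAt j 0 a)

lexicalCoeff-remove-0 : ∀ α (p q : Monomial) → lexicalCoeff α (p ++ 0 ∷ q) ≡ lexicalCoeff α (p ++ q)
lexicalCoeff-remove-0 α p q rewrite ++-∷-insertAt p 0 q | length-insertAt (length p) 0 (p ++ q) =
  tableauCount-insertAt-0 (length p) (length (p ++ q)) (subst (length p ≤_) (sym (length-++ p)) (m≤m+n _ _)) (p ++ q) α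

lexicalCoeff-flatten : ∀ α a → lexicalCoeff α a ≡ lexicalCoeff α (flatten a)
lexicalCoeff-flatten α = after []
  where
  after : ∀ p a → lexicalCoeff α (p ++ a) ≡ lexicalCoeff α (p ++ flatten a)
  after p [] = refl
  after p (zero ∷ a) = trans (lexicalCoeff-remove-0 α p a) (after p a)
  after p (suc b ∷ a) = begin
      lexicalCoeff α (p ++ suc b ∷ a)        ≡⟨ cong (lexicalCoeff α) (sym (++-assoc p (suc b ∷ []) a)) ⟩
      lexicalCoeff α ((p ++ suc b ∷ []) ++ a) ≡⟨ after (p ++ suc b ∷ []) a ⟩
      lexicalCoeff α ((p ++ suc b ∷ []) ++ flatten a) ≡⟨ cong (lexicalCoeff α) (++-assoc p (suc b ∷ []) (flatten a)) ⟩
      lexicalCoeff α (p ++ suc b ∷ flatten a) ∎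
    where open ≡-Reasoning

indicator : ℕ → ℕ → ℕ
indicator x i = if i ≡ᵇ x then 1 else 0

sum-indicator-letters-suc : ∀ m y →
  sum (map (indicator (suc y)) (letters (suc m))) ≡ indicator y 0 + sum (map (indicator y) (letters m))
sum-indicator-letters-suc m y =
  trans (cong (sum ∘ map (indicator (suc y))) (letters-suc m)) (cong (λ l → indicator y 0 + sum l) (sym (map-∘ (letters m))))

sum-indicator-0-letters : ∀ m → sum (map (indicator 0) (letters m)) ≡ 0
sum-indicator-0-letters m = begin
    sum (map (indicator 0) (letters m))          ≡⟨ cong (sum ∘ map (indicator 0)) (sym (map-applyUpTo id suc m)) ⟩
    sum (map (indicator 0) (map suc (upTo m)))   ≡⟨ cong sum (sym (map-∘ (upTo m))) ⟩
    sum (map (indicator 0 ∘ suc) (upTo m))       ≡⟨ sum-map-zero _ (λ _ → refl) (upTo m) ⟩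
    0                                            ∎
  where open ≡-Reasoning

sum-indicator-letters : ∀ m x → IsLetter m x → sum (map (indicator x) (letters m)) ≡ 1
sum-indicator-letters (suc m) (suc zero) _ =
  trans (sum-indicator-letters-suc m 0) (cong suc (sum-indicator-0-letters m))
sum-indicator-letters (suc m) (suc (suc y)) (_ , s≤s y<m) =
  trans (sum-indicator-letters-suc m (suc y)) (sum-indicator-letters m (suc y) (s≤s z≤n , y<m))

sum-count-letters : ∀ m E → All (IsLetter m) E → sum (map (λ i → count i E) (letters m)) ≡ length E
sum-count-letters m [] [] = sum-map-zero _ (λ _ → refl) (letters m)
sum-count-letters m (x ∷ E) (x-letter ∷ E-letters) =
  trans (sum-map-+ (indicator x) (λ i → count i E) (letters m))
        (cong₂ _+_ (sum-indicator-letters m x x-letter) (sum-count-letters m E E-letters))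

length-entries : ∀ T → length (entries T) ≡ sum (map length T)
length-entries [] = refl
length-entries (r ∷ T) = trans (length-++ r) (cong (length r +_) (length-entries T))

sum-content : ∀ {m α T} → T ∈ fillings m α → sum (content m T) ≡ sum α
sum-content {m} {α} {T} T∈ with ∈-fillings⁻ {m} {α} T∈
... | refl , T-letters = trans (sum-count-letters m (entries T) (concat⁺ T-letters)) (length-entries T)

lexicalCoeff-homogeneous : ∀ α a → degree a ≢ sum α → lexicalCoeff α a ≡ 0
lexicalCoeff-homogeneous α a deg≢ with lexicalCoeff α a ≟ 0
... | yes coeff≡0 = coeff≡0
... | no coeff≢0 with lexicalCoeff≢0⇒∃tableau α a coeff≢0
... | T , T∈ , _ , content≡a = ⊥-elim (deg≢ (trans (cong sum (sym content≡a)) (sum-content {length a} {α} T∈)))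

_≤ˡᵉˣ_ : List ℕ → List ℕ → Set
_≤ˡᵉˣ_ = Lex-≤ _≡_ _<_

≤ˡᵉˣ-isDecTotalOrder : IsDecTotalOrder _≡_ _≤ˡᵉˣ_
≤ˡᵉˣ-isDecTotalOrder = record
  { isTotalOrder = record
    { isPartialOrder = record
      { isPreorder = record
        { isEquivalence = isEquivalence
        ; reflexive = λ { refl → Lex≋.refl }
        ; trans = Lex≋.trans
        }
      ; antisym = λ p q → Pointwise-≡⇒≡ (Lex≋.antisym p q)
      }
    ; total = Lex≋.total
    }
  ; _≟_ = ≡-dec _≟_
  ; _≤?_ = Lex≋._≤?_
  }
  where module Lex≋ = IsDecTotalOrder (Lex.≤-isDecTotalOrder <-isStrictTotalOrder)

lexLeq-head : ∀ {h w y z} → lexLeq (h ∷ w) (y ∷ z) ≡ true → h ≤ y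
lexLeq-head {h} {y = y} le with h <ᵇ y in h<y
... | true = <⇒≤ (<ᵇ-true⇒< h<y)
... | false = ≤-reflexive (≡ᵇ-true⇒≡ (∧-trueˡ le))

-- Every cyclic shift starting at y is weakly larger than the word, so y ≥ h.
isNecklace⇒head≤ : ∀ h w → isNecklace (h ∷ w) ≡ true → All (h ≤_) (h ∷ w)
isNecklace⇒head≤ h w neck = tabulate head≤
  where
  head≤ : ∀ {y} → y ∈ h ∷ w → h ≤ y
  head≤ y∈ with drop-∈ (h ∷ w) y∈
  ... | k , rest , k<len , drop≡ =
    lexLeq-head {w = w} {z = rest ++ take k (h ∷ w)} (subst (λ v → lexLeq (h ∷ w) (v ++ take k (h ∷ w)) ≡ true) drop≡
                       (allB-∈ (λ k → lexLeq (h ∷ w) (rotate k (h ∷ w))) neck (∈-upTo⁺ k<len)))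

strictlyIncreasing⇒head< : ∀ x l → strictlyIncreasing (x ∷ l) ≡ true → All (x <_) l
strictlyIncreasing⇒head< x [] _ = []
strictlyIncreasing⇒head< x (y ∷ l) inc =
  x<y ∷ All.map (<-trans x<y) (strictlyIncreasing⇒head< y l (∧-trueʳ {x <ᵇ y} inc))
  where x<y = <ᵇ-true⇒< (∧-trueˡ inc)

necklaces-above : ∀ f T → allB isNecklace T ≡ true → All (f <_) (firstColumn T) → All (All (f <_)) T
necklaces-above f [] _ [] = []
necklaces-above f ([] ∷ T) necks f< = [] ∷ necklaces-above f T necks f<
necklaces-above f ((h ∷ w) ∷ T) necks (f<h ∷ f<) =
  All.map (<-≤-trans f<h) (isNecklace⇒head≤ h w (∧-trueˡ necks))
  ∷ necklaces-above f T (∧-trueʳ {isNecklace (h ∷ w)} necks) f<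

isLexical⇒above-bottom : ∀ f r T → isLexical ((f ∷ r) ∷ T) ≡ true → All (f <_) (entries T)
isLexical⇒above-bottom f r T lex = concat⁺ (necklaces-above f T (∧-trueʳ {isNecklace (f ∷ r)} (∧-trueʳ {strictlyIncreasing (f ∷ firstColumn T)} lex))
                                              (strictlyIncreasing⇒head< f (firstColumn T) (∧-trueˡ lex)))

isLexical-tail : ∀ f r T → isLexical ((f ∷ r) ∷ T) ≡ true → isLexical T ≡ true
isLexical-tail f r T lex = ∧-true (strictlyIncreasing-tail f (firstColumn T) (∧-trueˡ lex))
                                  (∧-trueʳ {isNecklace (f ∷ r)} (∧-trueʳ {strictlyIncreasing (f ∷ firstColumn T)} lex))
  where
  strictlyIncreasing-tail : ∀ x l → strictlyIncreasing (x ∷ l) ≡ true → strictlyIncreasing l ≡ true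
  strictlyIncreasing-tail x [] _ = refl
  strictlyIncreasing-tail x (y ∷ l) inc = ∧-trueʳ {x <ᵇ y} inc

-- Peeling off the bottom row: the 1s of a lexical tableau all lie in its bottom row, so its
-- length bounds the leading exponent, and if it is filled with 1s the rest is again lexical.
lexicalCoeff≢0⇒≤ˡᵉˣ : ∀ α β → All (1 ≤_) α → All (1 ≤_) β → lexicalCoeff α β ≢ 0 → β ≤ˡᵉˣ α
lexicalCoeff≢0⇒≤ˡᵉˣ [] [] _ _ _ = base _
lexicalCoeff≢0⇒≤ˡᵉˣ (k ∷ α) [] _ _ _ = halt
lexicalCoeff≢0⇒≤ˡᵉˣ [] (suc b ∷ β) _ _ coeff≢0 = ⊥-elim (coeff≢0 refl)
lexicalCoeff≢0⇒≤ˡᵉˣ [] (zero ∷ β) _ (() ∷ _) _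
lexicalCoeff≢0⇒≤ˡᵉˣ (k ∷ α) (b ∷ β) (k≥1 ∷ α⁺) (_ ∷ β⁺) coeff≢0
  with lexicalCoeff≢0⇒∃tableau (k ∷ α) (b ∷ β) coeff≢0
... | T , T∈ , lex , content≡ with ∈-conses⁻ (words (suc (length β)) k) (fillings (suc (length β)) α) T∈
... | [] , T′ , refl , r∈ , T′∈ with ∈-words⁻ {suc (length β)} {k} r∈
...   | refl , _ = ⊥-elim (<-irrefl refl k≥1)
lexicalCoeff≢0⇒≤ˡᵉˣ (k ∷ α) (b ∷ β) (k≥1 ∷ α⁺) (_ ∷ β⁺) coeff≢0
  | T , T∈ , lex , content≡ | f ∷ r′ , T′ , refl , r∈ , T′∈ with ∈-words⁻ {suc (length β)} {k} r∈
...   | refl , r-letters = bottom-row (m≤n⇒m<n∨m≡n (subst (_≤ k) count₁≡b (count-≤-length 1 (f ∷ r′))))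
  where
  m = length β
  f≥1 = proj₁ (All.head r-letters)
  T′-1-free : occurrences T′ 1 ≡ 0
  T′-1-free = count-All≢ 1 (entries T′)
    (All.map (λ f< → <⇒≢ (≤-<-trans f≥1 f<)) (isLexical⇒above-bottom f r′ T′ lex))
  count₁≡b : count 1 (f ∷ r′) ≡ b
  count₁≡b = trans (sym (trans (occurrences-∷ 1 (f ∷ r′) T′) (trans (cong (_ +_) T′-1-free) (+-identityʳ _))))
                   (∷-injectiveˡ (trans (sym (content-suc m ((f ∷ r′) ∷ T′))) content≡))
  bottom-row : b < k ⊎ b ≡ k → (b ∷ β) ≤ˡᵉˣ (k ∷ α)
  bottom-row (inj₁ b<k) = this b<k
  bottom-row (inj₂ refl) = next refl (lexicalCoeff≢0⇒≤ˡᵉˣ α β α⁺ β⁺ coeff′≢0)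
    where
    T′-content : content (suc m) T′ ≡ 0 ∷ β
    T′-content = trans (content-suc m T′)
      (cong₂ _∷_ T′-1-free (∷-injectiveʳ (trans (sym (content-ones-∷ m (f ∷ r′) T′ (count≡length⇒All≡ 1 (f ∷ r′) count₁≡b)))
                                                content≡)))
    coeff′≢0 : lexicalCoeff α β ≢ 0
    coeff′≢0 = subst (_≢ 0) (lexicalCoeff-remove-0 α [] β)
                 (tableau⇒lexicalCoeff≢0 α (0 ∷ β) T′ (T′∈ , isLexical-tail f r′ T′ lex , T′-content))

rotate-replicate : ∀ j n x → rotate j (replicate n x) ≡ replicate n x
rotate-replicate zero n x = ++-identityʳ (replicate n x)
rotate-replicate (suc j) zero x = refl
rotate-replicate (suc j) (suc n) x = begin
    drop j (replicate n x) ++ x ∷ take j (replicate n x)    ≡⟨ cong (_++ x ∷ take j (replicate n x)) (drop-replicate j n x) ⟩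
    replicate (n ∸ j) x ++ x ∷ take j (replicate n x)       ≡⟨ replicate-++-∷ (n ∸ j) x (take j (replicate n x)) ⟩
    x ∷ replicate (n ∸ j) x ++ take j (replicate n x)       ≡⟨ cong (λ l → x ∷ l ++ take j (replicate n x)) (sym (drop-replicate j n x)) ⟩
    x ∷ rotate j (replicate n x)                            ≡⟨ cong (x ∷_) (rotate-replicate j n x) ⟩
    x ∷ replicate n x                                       ∎
  where open ≡-Reasoning

lexLeq-refl : ∀ w → lexLeq w w ≡ true
lexLeq-refl [] = refl
lexLeq-refl (x ∷ w) rewrite <ᵇ-irrefl x | ≡ᵇ-refl x = lexLeq-refl w

isNecklace-replicate : ∀ n x → isNecklace (replicate n x) ≡ true
isNecklace-replicate n x = allB-true (λ k → lexLeq (replicate n x) (rotate k (replicate n x))) (λ k → subst (λ v → lexLeq (replicate n x) v ≡ true)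
                                                 (sym (rotate-replicate k n x)) (lexLeq-refl (replicate n x))) (upTo (length (replicate n x)))

firstColumn-All : ∀ {P : ℕ → Set} T → All (All P) T → All P (firstColumn T)
firstColumn-All [] [] = []
firstColumn-All ([] ∷ T) (_ ∷ PT) = firstColumn-All T PT
firstColumn-All ((x ∷ r) ∷ T) ((Px ∷ _) ∷ PT) = Px ∷ firstColumn-All T PT

strictlyIncreasing-1∷punchIn-0 : ∀ l → All (1 ≤_) l → strictlyIncreasing l ≡ true →
  strictlyIncreasing (1 ∷ map (punchIn 0) l) ≡ true
strictlyIncreasing-1∷punchIn-0 [] _ _ = refl
strictlyIncreasing-1∷punchIn-0 (zero ∷ l) (() ∷ _) _
strictlyIncreasing-1∷punchIn-0 (suc x ∷ l) _ inc = trans (PunchIn.strictlyIncreasing-map 0 (suc x ∷ l)) inc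

replicate-1∈words : ∀ m n → replicate n 1 ∈ words (suc m) n
replicate-1∈words m zero = here refl
replicate-1∈words m (suc n) = ∈-conses⁺ (letters (suc m)) (words (suc m) n) (here refl) (replicate-1∈words m n)

∈-fillings-relabel-punchIn : ∀ {j m α T} → j ≤ m → T ∈ fillings m α → relabel (punchIn j) T ∈ fillings (suc m) α
∈-fillings-relabel-punchIn {j} {m} {α} {T} j≤m T∈ =
  proj₁ (∈-filter⁻ (T? ∘ allB (allB (avoids (suc j))))
                   (subst (relabel (punchIn j) T ∈_) (sym (filterᵇ-avoids-fillings j m j≤m α)) (∈-map⁺ (relabel (punchIn j)) T∈)))

isLexical-ones-∷-relabel : ∀ k D → All (All (1 ≤_)) D → isLexical D ≡ true →
  isLexical (replicate (suc k) 1 ∷ relabel (punchIn 0) D) ≡ true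
isLexical-ones-∷-relabel k D D⁺ lexD = ∧-true
  (trans (cong (strictlyIncreasing ∘ (1 ∷_)) (PunchIn.firstColumn-map 0 D))
         (strictlyIncreasing-1∷punchIn-0 (firstColumn D) (firstColumn-All D D⁺) (∧-trueˡ lexD)))
  (∧-true (isNecklace-replicate (suc k) 1)
          (trans (PunchIn.allB-isNecklace-map 0 D) (∧-trueʳ {strictlyIncreasing (firstColumn D)} lexD)))

content-ones-∷-relabel : ∀ m k D → content (suc m) (replicate k 1 ∷ relabel (punchIn 0) D) ≡ k ∷ content m D
content-ones-∷-relabel m k D = trans (content-ones-∷ m (replicate k 1) (relabel (punchIn 0) D) (replicate⁺ k refl))
  (cong₂ _∷_ (trans (cong₂ _+_ (length-replicate k) (occurrences-relabel-punchIn-gap 0 D)) (+-identityʳ k))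
             (trans (map-cong (λ i → occurrences-relabel-punchIn 0 (suc i) D) (upTo m)) (sym (content-upTo m D))))

-- Row i of the diagonal tableau is i repeated α_i times.
diagonalTableau : List ℕ → List (List ℕ)
diagonalTableau [] = []
diagonalTableau (k ∷ α) = replicate k 1 ∷ relabel (punchIn 0) (diagonalTableau α)

diagonalTableau-isLexicalTableau : ∀ α → All (1 ≤_) α → IsLexicalTableau (length α) α α (diagonalTableau α)
diagonalTableau-isLexicalTableau [] [] = here refl , refl , refl
diagonalTableau-isLexicalTableau (suc k ∷ α) (_ ∷ α⁺) with diagonalTableau-isLexicalTableau α α⁺
... | D∈ , lexD , contentD =
  ∈-conses⁺ (words (suc m) (suc k)) (fillings (suc m) α) (replicate-1∈words m (suc k)) (∈-fillings-relabel-punchIn {0} {m} {α} z≤n D∈) ,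
  isLexical-ones-∷-relabel k D (All.map (All.map proj₁) (proj₂ (∈-fillings⁻ {m} {α} D∈))) lexD ,
  trans (content-ones-∷-relabel m (suc k) D) (cong (suc k ∷_) contentD)
  where
  m = length α
  D = diagonalTableau α

lexicalCoeff-diagonal≢0 : ∀ α → All (1 ≤_) α → lexicalCoeff α α ≢ 0
lexicalCoeff-diagonal≢0 α α⁺ = tableau⇒lexicalCoeff≢0 α α (diagonalTableau α) (diagonalTableau-isLexicalTableau α α⁺)

extend : List ℕ → List (List ℕ)
extend [] = (1 ∷ []) ∷ []
extend (b ∷ β) = (1 ∷ b ∷ β) ∷ (suc b ∷ β) ∷ []

compositions-suc : ∀ n → compositions (suc n) ≡ concatMap extend (compositions n)
compositions-suc n = concatMap-cong (λ { [] → refl ; (b ∷ β) → refl }) (compositions n)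

∈-compositions⁻ : ∀ n {α} → α ∈ compositions n → sum α ≡ n × All (1 ≤_) α
∈-compositions⁻ zero (here refl) = refl , []
∈-compositions⁻ (suc n) {α} α∈
  with find (∈-concatMap⁻ extend {xs = compositions n} (subst (α ∈_) (compositions-suc n) α∈))
... | [] , β∈ , here refl with ∈-compositions⁻ n β∈
...   | refl , [] = refl , s≤s z≤n ∷ []
∈-compositions⁻ (suc n) α∈ | b ∷ β , β∈ , here refl with ∈-compositions⁻ n β∈
...   | refl , β⁺ = refl , s≤s z≤n ∷ β⁺
∈-compositions⁻ (suc n) α∈ | b ∷ β , β∈ , there (here refl) with ∈-compositions⁻ n β∈
...   | refl , _ ∷ β⁺ = refl , s≤s z≤n ∷ β⁺

∈-compositions⁺ : ∀ α → All (1 ≤_) α → α ∈ compositions (sum α)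
∈-compositions⁺ [] [] = here refl
∈-compositions⁺ (zero ∷ β) (() ∷ _)
∈-compositions⁺ (suc zero ∷ []) _ = here refl
∈-compositions⁺ (suc zero ∷ b ∷ β) (_ ∷ b⁺ ∷ β⁺) =
  subst ((1 ∷ b ∷ β) ∈_) (sym (compositions-suc (b + sum β)))
        (∈-concatMap⁺ extend (lose (∈-compositions⁺ (b ∷ β) (b⁺ ∷ β⁺)) (here refl)))
∈-compositions⁺ (suc (suc b) ∷ β) (_ ∷ β⁺) =
  subst ((suc (suc b) ∷ β) ∈_) (sym (compositions-suc (suc b + sum β)))
        (∈-concatMap⁺ extend (lose (∈-compositions⁺ (suc b ∷ β) (s≤s z≤n ∷ β⁺)) (there (here refl))))

flatten-positive : ∀ a → All (1 ≤_) (flatten a)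
flatten-positive [] = []
flatten-positive (zero ∷ a) = flatten-positive a
flatten-positive (suc b ∷ a) = s≤s z≤n ∷ flatten-positive a

sum-flatten : ∀ a → sum (flatten a) ≡ sum a
sum-flatten [] = refl
sum-flatten (zero ∷ a) = sum-flatten a
sum-flatten (suc b ∷ a) = cong (suc b +_) (sum-flatten a)

flatten∈compositions : ∀ a → flatten a ∈ compositions (degree a)
flatten∈compositions a = subst (λ n → flatten a ∈ compositions n) (sum-flatten a) (∈-compositions⁺ (flatten a) (flatten-positive a))

toℚ-mkℚ : ∀ n → toℚ n ≡ mkℚ (ℤ.+ n) 0 (Coprime-sym (1-coprimeTo n))
toℚ-mkℚ n = ℚ.normalize-coprime (Coprime-sym (1-coprimeTo n))

toℚ-suc : ∀ n → toℚ (suc n) ≡ 1ℚ +ℚ toℚ n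
toℚ-suc n = trans (cong (_/ 1) (cong (ℤ._+_ (ℤ.+ 1)) (sym (ℤ.*-identityʳ (ℤ.+ n)))))
                  (cong (1ℚ +ℚ_) (sym (toℚ-mkℚ n)))

toℚ-suc≢0 : ∀ n → toℚ (suc n) ≢ 0ℚ
toℚ-suc≢0 n eq with trans (sym (toℚ-mkℚ (suc n))) eq
... | ()

toℚ≡0⇒≡0 : ∀ {n} → toℚ n ≡ 0ℚ → n ≡ 0
toℚ≡0⇒≡0 {zero} _ = refl
toℚ≡0⇒≡0 {suc n} eq = ⊥-elim (toℚ-suc≢0 n eq)

*-zero-divisorˡ : ∀ x y → x *ℚ y ≡ 0ℚ → y ≢ 0ℚ → x ≡ 0ℚ
*-zero-divisorˡ x y xy≡0 y≢0 = begin
    x                      ≡⟨ sym (ℚ.*-identityʳ x) ⟩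
    x *ℚ 1ℚ                ≡⟨ cong (x *ℚ_) (sym (ℚ.*-inverseʳ y)) ⟩
    x *ℚ (y *ℚ 1/ y)       ≡⟨ sym (ℚ.*-assoc x y (1/ y)) ⟩
    x *ℚ y *ℚ 1/ y         ≡⟨ cong (_*ℚ 1/ y) xy≡0 ⟩
    0ℚ *ℚ 1/ y             ≡⟨ ℚ.*-zeroˡ (1/ y) ⟩
    0ℚ                     ∎
  where
  open ≡-Reasoning
  instance y-nonZero : NonZero y
  y-nonZero = ≢-nonZero y≢0

*-zero-divisorʳ : ∀ x y → x *ℚ y ≡ 0ℚ → x ≢ 0ℚ → y ≡ 0ℚ
*-zero-divisorʳ x y xy≡0 x≢0 = *-zero-divisorˡ y x (trans (ℚ.*-comm y x) xy≡0) x≢0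

sumℚ : ∀ {A : Set} → List A → (A → ℚ) → ℚ
sumℚ S h = foldr (λ x acc → h x +ℚ acc) 0ℚ S

sumℚ-cong : ∀ {A : Set} (S : List A) {h h′ : A → ℚ} → (∀ {x} → x ∈ S → h x ≡ h′ x) → sumℚ S h ≡ sumℚ S h′
sumℚ-cong [] _ = refl
sumℚ-cong (x ∷ S) h≡h′ = cong₂ _+ℚ_ (h≡h′ (here refl)) (sumℚ-cong S (h≡h′ ∘ there))

sumℚ-zero : ∀ {A : Set} (S : List A) {h : A → ℚ} → (∀ {x} → x ∈ S → h x ≡ 0ℚ) → sumℚ S h ≡ 0ℚ
sumℚ-zero [] _ = refl
sumℚ-zero (x ∷ S) h≡0 = trans (cong₂ _+ℚ_ (h≡0 (here refl)) (sumℚ-zero S (h≡0 ∘ there))) (ℚ.+-identityˡ 0ℚ)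

sumℚ-+ : ∀ {A : Set} (S : List A) (h h′ : A → ℚ) → sumℚ S (λ x → h x +ℚ h′ x) ≡ sumℚ S h +ℚ sumℚ S h′
sumℚ-+ [] h h′ = sym (ℚ.+-identityˡ 0ℚ)
sumℚ-+ (x ∷ S) h h′ = trans (cong (h x +ℚ h′ x +ℚ_) (sumℚ-+ S h h′)) (+ℚ-interchange (h x) (h′ x) _ _)

sumℚ-++ : ∀ {A : Set} (S S′ : List A) h → sumℚ (S ++ S′) h ≡ sumℚ S h +ℚ sumℚ S′ h
sumℚ-++ [] S′ h = sym (ℚ.+-identityˡ _)
sumℚ-++ (x ∷ S) S′ h = trans (cong (h x +ℚ_) (sumℚ-++ S S′ h)) (sym (ℚ.+-assoc (h x) _ _))

sumℚ-unique : ∀ {A : Set} {S : List A} h {d} → Unique S → d ∈ S → (∀ {x} → x ∈ S → x ≢ d → h x ≡ 0ℚ) → sumℚ S h ≡ h d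
sumℚ-unique {S = x ∷ S} h (x∉S ∷ S!) (here refl) h≡0 =
  trans (cong (h x +ℚ_) (sumℚ-zero S (λ x′∈ → h≡0 (there x′∈) (λ { refl → All.lookup x∉S x′∈ refl })))) (ℚ.+-identityʳ (h x))
sumℚ-unique {S = x ∷ S} h (x∉S ∷ S!) (there d∈) h≡0 =
  trans (cong (_+ℚ sumℚ S h) (h≡0 (here refl) (λ { refl → All.lookup x∉S d∈ refl })))
        (trans (ℚ.+-identityˡ _) (sumℚ-unique h S! d∈ (h≡0 ∘ there)))

sumℚ-concentrated : ∀ {A : Set} (_≟_ : DecidableEquality A) (S : List A) h d →
  (∀ {x} → x ∈ S → x ≢ d → h x ≡ 0ℚ) → sumℚ S h ≡ toℚ (length (filter (_≟ d) S)) *ℚ h d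
sumℚ-concentrated _≟_ [] h d _ = sym (ℚ.*-zeroˡ (h d))
sumℚ-concentrated _≟_ (x ∷ S) h d h≡0 with x ≟ d
... | yes refl = begin
    h x +ℚ sumℚ S h                           ≡⟨ cong (h x +ℚ_) (sumℚ-concentrated _≟_ S h x (h≡0 ∘ there)) ⟩
    h x +ℚ toℚ k *ℚ h x                       ≡⟨ cong (_+ℚ toℚ k *ℚ h x) (sym (ℚ.*-identityˡ (h x))) ⟩
    1ℚ *ℚ h x +ℚ toℚ k *ℚ h x                 ≡⟨ sym (ℚ.*-distribʳ-+ (h x) 1ℚ (toℚ k)) ⟩
    (1ℚ +ℚ toℚ k) *ℚ h x                      ≡⟨ cong (_*ℚ h x) (sym (toℚ-suc k)) ⟩
    toℚ (suc k) *ℚ h x                        ∎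
  where
  open ≡-Reasoning
  k = length (filter (_≟ x) S)
... | no x≢d = trans (cong₂ _+ℚ_ (h≡0 (here refl) x≢d) (sumℚ-concentrated _≟_ S h d (h≡0 ∘ there))) (ℚ.+-identityˡ _)

module Unitriangular {A : Set} {_≼_ : Rel A 0ℓ} (≼-isDecTotalOrder : IsDecTotalOrder _≡_ _≼_)
  (S : List A) (C : A → A → ℚ)
  (C-triangular : ∀ {α β} → α ∈ S → β ∈ S → C α β ≢ 0ℚ → β ≼ α)
  (C-diagonal : ∀ {α} → α ∈ S → C α α ≢ 0ℚ) where

  open IsDecTotalOrder ≼-isDecTotalOrder using (antisym) renaming (_≟_ to _≟ᴬ_; _≤?_ to _≼?_; refl to ≼-refl; trans to ≼-trans)

  ≼-totalOrder : TotalOrder 0ℓ 0ℓ 0ℓ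
  ≼-totalOrder = record { isTotalOrder = IsDecTotalOrder.isTotalOrder ≼-isDecTotalOrder }

  open Extrema ≼-totalOrder using (max; ⊥≤max; xs≤max; argmax-sel)

  combination : (A → ℚ) → A → ℚ
  combination c β = sumℚ S (λ α → c α *ℚ C α β)

  nonzero? : (g : A → ℚ) → Decidable (λ α → g α ≢ 0ℚ)
  nonzero? g α = ¬? (g α ℚ.≟ 0ℚ)

  support : (A → ℚ) → List A
  support g = filter (nonzero? g) S

  IsTopOfSupport : (A → ℚ) → A → Set
  IsTopOfSupport g μ = μ ∈ S × g μ ≢ 0ℚ × (∀ {γ} → γ ∈ S → g γ ≢ 0ℚ → γ ≼ μ)

  support-top : ∀ g {α} → α ∈ S → g α ≢ 0ℚ → ∃ (IsTopOfSupport g)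
  support-top g α∈ gα≢0 with support g in support≡ | ∈-filter⁺ (nonzero? g) α∈ gα≢0
  ... | δ ∷ D | _ = max δ D , proj₁ max∈S×≢0 , proj₂ max∈S×≢0 , top
    where
    ∈support : ∀ {γ} → γ ∈ δ ∷ D → γ ∈ support g
    ∈support = subst (_ ∈_) (sym support≡)
    max∈ : max δ D ∈ δ ∷ D
    max∈ = [ here , there ]′ (argmax-sel id δ D)
    max∈S×≢0 : max δ D ∈ S × g (max δ D) ≢ 0ℚ
    max∈S×≢0 = ∈-filter⁻ (nonzero? g) (∈support max∈)
    top : ∀ {γ} → γ ∈ S → g γ ≢ 0ℚ → γ ≼ max δ D
    top γ∈ gγ≢0 with subst (_ ∈_) support≡ (∈-filter⁺ (nonzero? g) γ∈ gγ≢0)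
    ... | here refl = ⊥≤max δ D
    ... | there γ∈D = All.lookup (xs≤max δ D) γ∈D

  multiplicity : A → ℕ
  multiplicity μ = length (filter (_≟ᴬ μ) S)

  toℚ-multiplicity≢0 : ∀ {μ} → μ ∈ S → toℚ (multiplicity μ) ≢ 0ℚ
  toℚ-multiplicity≢0 {μ} μ∈ eq = m<n⇒n≢0 (filter-some (_≟ᴬ μ) (lose μ∈ refl)) (toℚ≡0⇒≡0 eq)

  independent : ∀ c → (∀ {β} → β ∈ S → combination c β ≡ 0ℚ) → ∀ {α} → α ∈ S → c α ≡ 0ℚ
  independent c c-kernel {α} α∈ with c α ℚ.≟ 0ℚ
  ... | yes cα≡0 = cα≡0
  ... | no cα≢0 with support-top c α∈ cα≢0
  ... | μ , μ∈ , cμ≢0 , μ-top = ⊥-elim (cμ≢0 cμ≡0)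
    where
    off-diagonal : ∀ {γ} → γ ∈ S → γ ≢ μ → c γ *ℚ C γ μ ≡ 0ℚ
    off-diagonal {γ} γ∈ γ≢μ with c γ ℚ.≟ 0ℚ | C γ μ ℚ.≟ 0ℚ
    ... | yes cγ≡0 | _ = trans (cong (_*ℚ C γ μ) cγ≡0) (ℚ.*-zeroˡ (C γ μ))
    ... | no _ | yes Cγμ≡0 = trans (cong (c γ *ℚ_) Cγμ≡0) (ℚ.*-zeroʳ (c γ))
    ... | no cγ≢0 | no Cγμ≢0 = ⊥-elim (γ≢μ (antisym (μ-top γ∈ cγ≢0) (C-triangular γ∈ μ∈ Cγμ≢0)))
    K·cμCμμ≡0 : toℚ (multiplicity μ) *ℚ (c μ *ℚ C μ μ) ≡ 0ℚ
    K·cμCμμ≡0 = trans (sym (sumℚ-concentrated _≟ᴬ_ S (λ γ → c γ *ℚ C γ μ) μ off-diagonal)) (c-kernel μ∈)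
    cμ≡0 : c μ ≡ 0ℚ
    cμ≡0 = *-zero-divisorˡ (c μ) (C μ μ)
             (*-zero-divisorʳ (toℚ (multiplicity μ)) _ K·cμCμμ≡0 (toℚ-multiplicity≢0 μ∈)) (C-diagonal μ∈)

  Represents : (A → ℚ) → (A → ℚ) → Set
  Represents g c = ∀ {β} → β ∈ S → g β ≡ combination c β

  shadowed? : (g : A → ℚ) → Decidable (λ β → Any (β ≼_) (support g))
  shadowed? g β = any? (β ≼?_) (support g)

  -- The termination measure of Gaussian elimination: it strictly shrinks at each step.
  shadow : (A → ℚ) → List A
  shadow g = filter (shadowed? g) S

  module Elimination (g : A → ℚ) {μ} (μ∈ : μ ∈ S) (gμ≢0 : g μ ≢ 0ℚ)
                     (μ-top : ∀ {γ} → γ ∈ S → g γ ≢ 0ℚ → γ ≼ μ) where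

    instance
      Cμμ-nonZero : NonZero (C μ μ)
      Cμμ-nonZero = ≢-nonZero (C-diagonal μ∈)
      K-nonZero : NonZero (toℚ (multiplicity μ))
      K-nonZero = ≢-nonZero (toℚ-multiplicity≢0 μ∈)

    s : ℚ
    s = g μ *ℚ 1/ C μ μ

    g′ : A → ℚ
    g′ β = g β -ℚ s *ℚ C μ β

    g′-μ : g′ μ ≡ 0ℚ
    g′-μ = trans (cong (g μ -ℚ_) (trans (ℚ.*-assoc (g μ) (1/ C μ μ) (C μ μ))
                                      (trans (cong (g μ *ℚ_) (ℚ.*-inverseˡ (C μ μ))) (ℚ.*-identityʳ (g μ)))))
                 (ℚ.+-inverseʳ (g μ))

    g′≢0⇒≼μ : ∀ {γ} → γ ∈ S → g′ γ ≢ 0ℚ → γ ≼ μ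
    g′≢0⇒≼μ {γ} γ∈ g′γ≢0 with g γ ℚ.≟ 0ℚ | C μ γ ℚ.≟ 0ℚ
    ... | no gγ≢0 | _ = μ-top γ∈ gγ≢0
    ... | yes _ | no Cμγ≢0 = C-triangular μ∈ γ∈ Cμγ≢0
    ... | yes gγ≡0 | yes Cμγ≡0 = ⊥-elim (g′γ≢0 (trans (cong₂ (λ x y → x -ℚ s *ℚ y) gγ≡0 Cμγ≡0)
                                                      (solve 1 (λ s → con 0ℚ :- s :* con 0ℚ := con 0ℚ) refl s)))

    shadow-shrinks : length (shadow g′) < length (shadow g)
    shadow-shrinks = length-filter-⊂ (shadowed? g′) (shadowed? g)
                       shadowed′⇒shadowed μ∈ (lose (∈-filter⁺ (nonzero? g) μ∈ gμ≢0) ≼-refl) μ-unshadowed′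
      where
      shadowed′⇒shadowed : ∀ {β} → Any (β ≼_) (support g′) → Any (β ≼_) (support g)
      shadowed′⇒shadowed p with find p
      ... | γ , γ∈ , β≼γ with ∈-filter⁻ (nonzero? g′) γ∈
      ... | γ∈S , g′γ≢0 = lose (∈-filter⁺ (nonzero? g) μ∈ gμ≢0) (≼-trans β≼γ (g′≢0⇒≼μ γ∈S g′γ≢0))
      μ-unshadowed′ : ¬ Any (μ ≼_) (support g′)
      μ-unshadowed′ p with find p
      ... | γ , γ∈ , μ≼γ with ∈-filter⁻ (nonzero? g′) γ∈
      ... | γ∈S , g′γ≢0 with antisym (g′≢0⇒≼μ γ∈S g′γ≢0) μ≼γ
      ... | refl = g′γ≢0 g′-μ

    correction : A → ℚ
    correction α = if does (α ≟ᴬ μ) then s *ℚ 1/ toℚ (multiplicity μ) else 0ℚ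

    correction-combination : ∀ β → sumℚ S (λ α → correction α *ℚ C α β) ≡ s *ℚ C μ β
    correction-combination β with μ ≟ᴬ μ in μ≟μ
    ... | no μ≢μ = ⊥-elim (μ≢μ refl)
    ... | yes _ = begin
        sumℚ S (λ α → correction α *ℚ C α β)
      ≡⟨ sumℚ-concentrated _≟ᴬ_ S (λ α → correction α *ℚ C α β) μ off-μ ⟩
        K *ℚ (correction μ *ℚ C μ β)
      ≡⟨ cong (λ d → K *ℚ ((if does d then s *ℚ 1/ K else 0ℚ) *ℚ C μ β)) μ≟μ ⟩
        K *ℚ (s *ℚ 1/ K *ℚ C μ β)
      ≡⟨ solve 4 (λ K k s x → K :* (s :* k :* x) := (K :* k) :* (s :* x)) refl K (1/ K) s (C μ β) ⟩
        K *ℚ 1/ K *ℚ (s *ℚ C μ β)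
      ≡⟨ cong (_*ℚ (s *ℚ C μ β)) (ℚ.*-inverseʳ K) ⟩
        1ℚ *ℚ (s *ℚ C μ β)
      ≡⟨ ℚ.*-identityˡ _ ⟩
        s *ℚ C μ β
      ∎
      where
      open ≡-Reasoning
      K = toℚ (multiplicity μ)
      off-μ : ∀ {α} → α ∈ S → α ≢ μ → correction α *ℚ C α β ≡ 0ℚ
      off-μ {α} _ α≢μ with α ≟ᴬ μ
      ... | yes α≡μ = ⊥-elim (α≢μ α≡μ)
      ... | no _ = ℚ.*-zeroˡ (C α β)

    lift : ∀ {c′} → Represents g′ c′ → Represents g (λ α → c′ α +ℚ correction α)
    lift {c′} c′-rep {β} β∈ = sym (begin
        sumℚ S (λ α → (c′ α +ℚ correction α) *ℚ C α β)
      ≡⟨ sumℚ-cong S (λ {α} _ → ℚ.*-distribʳ-+ (C α β) (c′ α) (correction α)) ⟩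
        sumℚ S (λ α → c′ α *ℚ C α β +ℚ correction α *ℚ C α β)
      ≡⟨ sumℚ-+ S (λ α → c′ α *ℚ C α β) (λ α → correction α *ℚ C α β) ⟩
        combination c′ β +ℚ sumℚ S (λ α → correction α *ℚ C α β)
      ≡⟨ cong₂ _+ℚ_ (sym (c′-rep β∈)) (correction-combination β) ⟩
        g β -ℚ s *ℚ C μ β +ℚ s *ℚ C μ β
      ≡⟨ solve 2 (λ x y → x :- y :+ y := x) refl (g β) (s *ℚ C μ β) ⟩
        g β
      ∎)
      where open ≡-Reasoning

  vanishes-or-top : ∀ g → (∀ {β} → β ∈ S → g β ≡ 0ℚ) ⊎ ∃ (IsTopOfSupport g)
  vanishes-or-top g with support g in support≡
  ... | [] = inj₁ g-vanishes
    where
    g-vanishes : ∀ {β} → β ∈ S → g β ≡ 0ℚ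
    g-vanishes {β} β∈ with g β ℚ.≟ 0ℚ
    ... | yes gβ≡0 = gβ≡0
    ... | no gβ≢0 with subst (β ∈_) support≡ (∈-filter⁺ (nonzero? g) β∈ gβ≢0)
    ... | ()
  ... | δ ∷ _ with ∈-filter⁻ (nonzero? g) (subst (δ ∈_) (sym support≡) (here refl))
  ... | δ∈ , gδ≢0 = inj₂ (support-top g δ∈ gδ≢0)

  spanning-below : ∀ n g → length (shadow g) < n → ∃ (Represents g)
  spanning-below (suc n) g shadow<n with vanishes-or-top g
  ... | inj₁ g≡0 = (λ _ → 0ℚ) , λ β∈ → trans (g≡0 β∈) (sym (sumℚ-zero S (λ {α} _ → ℚ.*-zeroˡ (C α _))))
  ... | inj₂ (μ , μ∈ , gμ≢0 , μ-top) =
    let open Elimination g μ∈ gμ≢0 μ-top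
        c′ , c′-rep = spanning-below n g′ (<-≤-trans shadow-shrinks (≤-pred shadow<n))
    in (λ α → c′ α +ℚ correction α) , lift {c′} c′-rep

  spanning : ∀ g → ∃ (Represents g)
  spanning g = spanning-below _ g (n<1+n _)

L*-quasisymmetric : ∀ α → IsQuasisymmetric (L* α)
L*-quasisymmetric α a = cong toℚ (lexicalCoeff-flatten α a)

L*-homogeneous : ∀ n {α} → α ∈ compositions n → IsHomogeneous n (L* α)
L*-homogeneous n {α} α∈ a deg≢n =
  cong toℚ (lexicalCoeff-homogeneous α a (λ deg≡ → deg≢n (trans deg≡ (proj₁ (∈-compositions⁻ n α∈)))))

L*-triangular : ∀ n {α β} → α ∈ compositions n → β ∈ compositions n → L* α β ≢ 0ℚ → β ≤ˡᵉˣ α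
L*-triangular n {α} {β} α∈ β∈ L≢0 = lexicalCoeff≢0⇒≤ˡᵉˣ α β (proj₂ (∈-compositions⁻ n α∈)) (proj₂ (∈-compositions⁻ n β∈))
                                      (L≢0 ∘ cong toℚ)

L*-diagonal : ∀ n {α} → α ∈ compositions n → L* α α ≢ 0ℚ
L*-diagonal n {α} α∈ = lexicalCoeff-diagonal≢0 α (proj₂ (∈-compositions⁻ n α∈)) ∘ toℚ≡0⇒≡0

module Degree (n : ℕ) = Unitriangular ≤ˡᵉˣ-isDecTotalOrder (compositions n) L* (L*-triangular n) (L*-diagonal n)

linComb-homogeneous : ∀ n c a → degree a ≢ n → linComb (compositions n) c L* a ≡ 0ℚ
linComb-homogeneous n c a deg≢n =
  sumℚ-zero (compositions n) (λ {α} α∈ → trans (cong (c α *ℚ_) (L*-homogeneous n α∈ a deg≢n)) (ℚ.*-zeroʳ (c α)))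

linComb-flatten : ∀ S c a → linComb S c L* a ≡ linComb S c L* (flatten a)
linComb-flatten S c a = sumℚ-cong S (λ {α} _ → cong (c α *ℚ_) (L*-quasisymmetric α a))

-- By quasisymmetry and homogeneity, an element of QSym_n is determined by its coefficients on compositions of n.
represents⇒linComb : ∀ n {f c} → InQSymₙ n f → Degree.Represents n f c → ∀ a → f a ≡ linComb (compositions n) c L* a
represents⇒linComb n {f} {c} (f-qsym , f-hom) f≡ a = by-degree (degree a ≟ n)
  where
  open ≡-Reasoning
  by-degree : Dec (degree a ≡ n) → f a ≡ linComb (compositions n) c L* a
  by-degree (no deg≢n) = trans (f-hom a deg≢n) (sym (linComb-homogeneous n c a deg≢n))
  by-degree (yes deg≡n) = begin
    f a                                       ≡⟨ f-qsym a ⟩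
    f (flatten a)                             ≡⟨ f≡ (subst (λ k → flatten a ∈ compositions k) deg≡n (flatten∈compositions a)) ⟩
    linComb (compositions n) c L* (flatten a) ≡⟨ sym (linComb-flatten (compositions n) c a) ⟩
    linComb (compositions n) c L* a           ∎

L*-basisOfQSymₙ : ∀ n → IsBasisOfQSymₙ n
L*-basisOfQSymₙ n = (λ α α∈ → L*-quasisymmetric α , L*-homogeneous n α∈)
         , (λ c c-kernel α α∈ → Degree.independent n c (λ {β} _ → c-kernel β) α∈)
         , (λ f f∈ → let c , f≡ = Degree.spanning n f in c , represents⇒linComb n {f} {c} f∈ f≡)

linComb-concatMap : ∀ ns c a →
  linComb (concatMap compositions ns) c L* a ≡ sumℚ ns (λ n → linComb (compositions n) c L* a)
linComb-concatMap [] c a = refl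
linComb-concatMap (n ∷ ns) c a =
  trans (sumℚ-++ (compositions n) (concatMap compositions ns) (λ α → c α *ℚ L* α a))
        (cong (linComb (compositions n) c L* a +ℚ_) (linComb-concatMap ns c a))

linComb-compositionsUpTo : ∀ N c a → degree a ≤ N →
  linComb (compositionsUpTo N) c L* a ≡ linComb (compositions (degree a)) c L* a
linComb-compositionsUpTo N c a deg≤N =
  trans (linComb-concatMap (upTo (suc N)) c a)
        (sumℚ-unique (λ n → linComb (compositions n) c L* a) (upTo⁺ (suc N)) (∈-upTo⁺ (s≤s deg≤N))
                     (λ {n} _ n≢deg → linComb-homogeneous n c a (n≢deg ∘ sym)))

linComb-compositionsUpTo-vanishes : ∀ N c a → N < degree a → linComb (compositionsUpTo N) c L* a ≡ 0ℚ
linComb-compositionsUpTo-vanishes N c a N<deg =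
  trans (linComb-concatMap (upTo (suc N)) c a)
        (sumℚ-zero (upTo (suc N)) {λ n → linComb (compositions n) c L* a} (λ {n} n∈ → linComb-homogeneous n c a
          (λ { refl → ≤⇒≯ (≤-pred (∈-upTo⁻ n∈)) N<deg })))

L*-independentUpTo : ∀ N c → (∀ a → linComb (compositionsUpTo N) c L* a ≡ 0ℚ) →
  ∀ α → α ∈ compositionsUpTo N → c α ≡ 0ℚ
L*-independentUpTo N c c-kernel α α∈ = in-degree (find (∈-concatMap⁻ compositions {xs = upTo (suc N)} α∈))
  where
  in-degree : (∃ λ d → d ∈ upTo (suc N) × α ∈ compositions d) → c α ≡ 0ℚ
  in-degree (d , d∈ , α∈d) = Degree.independent d c (λ {β} β∈ → kernel-d d (≤-pred (∈-upTo⁻ d∈)) β (proj₁ (∈-compositions⁻ d β∈))) α∈d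
    where
    kernel-d : ∀ d → d ≤ N → ∀ β → degree β ≡ d → linComb (compositions d) c L* β ≡ 0ℚ
    kernel-d .(degree β) d≤N β refl = trans (sym (linComb-compositionsUpTo N c β d≤N)) (c-kernel β)

homogeneousPart : ℕ → Series → Series
homogeneousPart n f a = if degree a ≡ᵇ n then f a else 0ℚ

homogeneousPart-≡ : ∀ n f a → degree a ≡ n → homogeneousPart n f a ≡ f a
homogeneousPart-≡ n f a deg≡n with degree a ≡ᵇ n in deg≡ᵇn
... | true = refl
... | false = ⊥-elim (subst T deg≡ᵇn (≡⇒≡ᵇ _ _ deg≡n))

homogeneousPart-≢ : ∀ n f a → degree a ≢ n → homogeneousPart n f a ≡ 0ℚ
homogeneousPart-≢ n f a deg≢n with degree a ≡ᵇ n in deg≡ᵇn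
... | true = ⊥-elim (deg≢n (≡ᵇ-true⇒≡ deg≡ᵇn))
... | false = refl

homogeneousPart-InQSymₙ : ∀ n f → IsQuasisymmetric f → InQSymₙ n (homogeneousPart n f)
homogeneousPart-InQSymₙ n f f-qsym = qsym , homogeneousPart-≢ n f
  where
  qsym : IsQuasisymmetric (homogeneousPart n f)
  qsym a rewrite sum-flatten a = cong (λ x → if degree a ≡ᵇ n then x else 0ℚ) (f-qsym a)

L*-spanningUpTo : ∀ f → InQSym f → Σ ℕ λ N → Σ (List ℕ → ℚ) λ c → ∀ a → f a ≡ linComb (compositionsUpTo N) c L* a
L*-spanningUpTo f (f-qsym , N , f-bounded) = N , c , f≡
  where
  coefficients : ∀ n → Σ (List ℕ → ℚ) λ cₙ → ∀ a → homogeneousPart n f a ≡ linComb (compositions n) cₙ L* a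
  coefficients n = proj₂ (proj₂ (L*-basisOfQSymₙ n)) (homogeneousPart n f) (homogeneousPart-InQSymₙ n f f-qsym)
  c : List ℕ → ℚ
  c α = proj₁ (coefficients (sum α)) α
  c-on-degree : ∀ n a → linComb (compositions n) c L* a ≡ homogeneousPart n f a
  c-on-degree n a = trans (sumℚ-cong (compositions n) (λ {α} α∈ →
                              cong (λ k → proj₁ (coefficients k) α *ℚ L* α a) (proj₁ (∈-compositions⁻ n α∈))))
                          (sym (proj₂ (coefficients n) a))
  by-degree : ∀ a → Dec (degree a ≤ N) → f a ≡ linComb (compositionsUpTo N) c L* a
  by-degree a (yes deg≤N) = sym (trans (linComb-compositionsUpTo N c a deg≤N)
                                       (trans (c-on-degree (degree a) a) (homogeneousPart-≡ _ f a refl)))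
  by-degree a (no deg≰N) = trans (f-bounded a (≰⇒> deg≰N)) (sym (linComb-compositionsUpTo-vanishes N c a (≰⇒> deg≰N)))
  f≡ : ∀ a → f a ≡ linComb (compositionsUpTo N) c L* a
  f≡ a = by-degree a (degree a ≤? N)

L*-basisOfQSym : IsBasisOfQSym
L*-basisOfQSym = (λ n α α∈ → L*-quasisymmetric α , n , λ a n<deg → L*-homogeneous n α∈ a (λ deg≡n → <-irrefl (sym deg≡n) n<deg))
      , L*-independentUpTo
      , L*-spanningUpTo

corollary4p4 : (∀ (n : ℕ) → IsBasisOfQSymₙ n) × IsBasisOfQSym
corollary4p4 = L*-basisOfQSymₙ , L*-basisOfQSym
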